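{- Let $M$ be a matroid on a finite ground set $E$ with $n=|E|$, and write $F(M,\mathbf{x})=\sum_\alpha c^M_\alpha L_\alpha$ (sum over compositions $\alpha$ of $n$). Then (i) all coefficients $c^M_\alpha$ are nonnegative; (ii) $\sum_\alpha c^M_\alpha=n!$; (iii) the coefficient $c^M_{(1,1,\ldots,1)}$ equals the number of bases of $M$.
   Context: For a matroid $M$ on finite ground set $E$ with bases $\mathcal{B}(M)$ and $f:E\to\mathbb{P}=\{1,2,\ldots\}$, $f$ is $M$-generic if the minimum of $f(B)=\sum_{e\in B}f(e)$ over bases is attained by a unique base; $F(M,\mathbf{x})=\sum_{f\ M\text{ -generic}}\prod_{e\in E}x_{f(e)}$. For a composition $\alpha=(\alpha_1,\ldots,\alpha_k)$, $M_\alpha=\sum_{i_1<\cdots<i_k}x_{i_1}^{\alpha_1}\cdots x_{i_k}^{\alpha_k}$, and the fundamental quasisymmetric function is $L_\alpha=\sum_\beta M_\beta$, summed over compositions $\beta$ refining $\alpha$ (i.e. $\alpha$ is obtained from $\beta$ by adding together consecutive parts). The $L_\alpha$ with $\alpha$ a composition of $n$ form a basis of the degree-$n$ quasisymmetric functions. -}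

module Defs where

open import Data.Nat using (ℕ; zero; suc; _+_; _∸_; _⊓_; _<ᵇ_; _≡ᵇ_)
open import Data.Bool using (Bool; true; false; if_then_else_; _∧_)
open import Data.List using (List; []; _∷_; map; concatMap; filter; length; foldr; upTo; allFin; replicate)
open import Data.Nat.ListAction using (sum)
open import Data.Vec as V using (Vec; lookup; toList)
open import Data.Fin using (Fin; toℕ)
import Data.Fin as Fin
open import Data.Fin.Subset using (Subset; _∈_; _∉_; _-_; _∪_; ⁅_⁆; inside; outside)
open import Data.Fin.Subset.Properties using (_∈?_)
open import Data.Product using (∃; _×_)
open import Relation.Unary using (Decidable)
open import Relation.Nullary using (does)
open import Relation.Binary.PropositionalEquality using (_≡_)
open import Data.Integer as ℤ using (ℤ; +_)

record Matroid (n : ℕ) : Set₁ where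
  field
    IsBase   : Subset n → Set
    isBase?  : Decidable IsBase
    base-exists : ∃ IsBase
    exchange : ∀ {B₁ B₂} → IsBase B₁ → IsBase B₂ →
               ∀ {x} → x ∈ B₁ → x ∉ B₂ →
               ∃ λ y → y ∈ B₂ × y ∉ B₁ × IsBase ((B₁ - x) ∪ ⁅ y ⁆)

allSubsets : (n : ℕ) → List (Subset n)
allSubsets zero    = V.[] ∷ []
allSubsets (suc n) = concatMap (λ s → (outside V.∷ s) ∷ (inside V.∷ s) ∷ []) (allSubsets n)

bases : ∀ {n} → Matroid n → List (Subset n)
bases {n} M = filter (Matroid.isBase? M) (allSubsets n)

#bases : ∀ {n} → Matroid n → ℕ
#bases M = length (bases M)

-- Genericity.  f : E → ℙ is represented by g : Fin n → ℕ (values ≥ 1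
-- are imposed where f is constructed below).

weight : ∀ {n} → (Fin n → ℕ) → Subset n → ℕ
weight {n} f B = sum (map (λ e → if does (e ∈? B) then f e else 0) (allFin n))

minList : List ℕ → ℕ
minList []       = 0
minList (x ∷ xs) = foldr _⊓_ x xs

isGeneric : ∀ {n} → Matroid n → (Fin n → ℕ) → Bool
isGeneric M f =
  length (filter (λ B → weight f B Data.Nat.≟ m) (bases M)) ≡ᵇ 1
  where
    open import Data.Nat using (_≟_)
    m = minList (map (weight f) (bases M))

-- Coefficients of F(M,x) restricted to variables x_1,…,x_N.
-- A function f : E → {1,…,N} is a vector h : Vec (Fin N) n with f(e) = 1 + toℕ (h e).

allFuns : (N n : ℕ) → List (Vec (Fin N) n)
allFuns N zero    = V.[] ∷ []
allFuns N (suc n) = concatMap (λ v → map (λ i → i V.∷ v) (allFin N)) (allFuns N n)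

asPos : ∀ {N n} → Vec (Fin N) n → Fin n → ℕ
asPos h e = suc (toℕ (lookup h e))

fiber : ∀ {N n} → Vec (Fin N) n → Fin N → ℕ
fiber h i = length (filter (λ j → j Fin.≟ i) (toList h))

hasExponent : ∀ {N n} → Vec (Fin N) n → Vec ℕ N → Bool
hasExponent {N} h a = foldr _∧_ true (map (λ i → fiber h i ≡ᵇ lookup a i) (allFin N))

-- coefficient of x_1^{a_1} ⋯ x_N^{a_N} in F(M,x)
coeffF : ∀ {n} → Matroid n → ∀ {N} → Vec ℕ N → ℕ
coeffF {n} M {N} a =
  length (filter (λ h → isGeneric M (asPos h) ∧ hasExponent h a ≡ᵇ' true) (allFuns N n))
  where
    open import Data.Bool using () renaming (_≟_ to _≡ᵇ'_)

compsFuel : ℕ → ℕ → List (List ℕ)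
compsFuel _       zero    = [] ∷ []
compsFuel zero    (suc _) = []
compsFuel (suc f) (suc n) =
  concatMap (λ k → map (suc k ∷_) (compsFuel f (n ∸ k))) (upTo (suc n))

comps : ℕ → List (List ℕ)
comps n = compsFuel n n

-- refines β α : α is obtained from β by adding together consecutive parts
-- (for β, α with positive parts)
refines : List ℕ → List ℕ → Bool
refines []      []      = true
refines []      (_ ∷ _) = false
refines (_ ∷ _) []      = false
refines (b ∷ β) (a ∷ α) =
  if b ≡ᵇ a then refines β α
  else if b <ᵇ a then refines β ((a ∸ b) ∷ α)
  else false

compress : ∀ {N} → Vec ℕ N → List ℕ
compress a = filter (λ k → 0 Data.Nat.<? k) (toList a)
  where open import Data.Nat using (_<?_)

listEq : List ℕ → List ℕ → Bool
listEq []       []       = true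
listEq (x ∷ xs) (y ∷ ys) = (x ≡ᵇ y) ∧ listEq xs ys
listEq _        _        = false

-- coefficient of x^a in M_β = Σ_{i_1<⋯<i_k} x_{i_1}^{β_1}⋯x_{i_k}^{β_k}
coeffM : List ℕ → ∀ {N} → Vec ℕ N → ℕ
coeffM β a = if listEq (compress a) β then 1 else 0

-- coefficient of x^a in L_α = Σ_{β refining α} M_β   (α a composition of n)
coeffL : (n : ℕ) → List ℕ → ∀ {N} → Vec ℕ N → ℕ
coeffL n α a = sum (map (λ β → if refines β α then coeffM β a else 0) (comps n))

expansionCoeff : (n : ℕ) → (List ℕ → ℤ) → ∀ {N} → Vec ℕ N → ℤ
expansionCoeff n c a = foldr ℤ._+_ (+ 0) (map (λ α → c α ℤ.* (+ coeffL n α a)) (comps n))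

-- F(M,x) = Σ_α c_α L_α  (equality of all coefficients, in every finite set of variables x_1..x_N)
IsLExpansion : ∀ {n} → Matroid n → (List ℕ → ℤ) → Set
IsLExpansion {n} M c = ∀ N (a : Vec ℕ N) → + coeffF M a ≡ expansionCoeff n c a

module Submission where

-- A weight f is M-generic exactly when some base B is a strict local minimum of f, i.e. f x < f y
-- whenever B - x + y is a base: the dual form of basis exchange then makes B the unique f-minimal
-- base. So F(M, x) sums, over the bases B, the generating functions of the maps strictly increasing
-- along the exchange relation of B. Labelling the elements of B above the others, Stanley's theory of
-- P-partitions expands each of these as the sum of L_{Des π} over the permutations π increasing along
-- that relation. Hence c_α counts the pairs (B, π) with descent composition α; it is unique because
-- the L_α are unitriangular with respect to refinement. Every injective f is generic and every L_α
-- contains x₁⋯xₙ once, so ∑ c_α = n!; and for each B only the permutation listing the elements by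
-- decreasing label has all its positions as descents.

module FundamentalExpansion where

  open import Level using (Level)
  open import Algebra.Bundles using (AbelianGroup)
  open import Data.Bool using (Bool; true; false; if_then_else_; _∧_; _∨_; not; T)
  import Data.Bool as Bool
  import Data.Bool.Properties as Bool
  open import Data.Empty using (⊥)
  open import Data.Fin using (Fin; zero; suc; toℕ; fromℕ<)
  import Data.Fin as Fin
  import Data.Fin.Properties as Fin
  open import Data.Fin.Subset using (Subset; inside; outside)
  import Data.Fin.Subset as Subset
  import Data.Fin.Subset.Properties as Subset
  open import Data.Integer as ℤ using (ℤ)
  import Data.Integer.Properties as ℤ
  open import Data.List using (List; []; _∷_; map; concatMap; filter; length; foldr; allFin; upTo; replicate; _++_; take; _∷ʳ_)
  open import Data.List.Properties using (map-cong; map-++; map-tabulate; length-replicate; length-tabulate; upTo-∷ʳ; filter-all; take-all)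
  import Data.List.Properties as List
  open import Data.List.Membership.Propositional using (_∈_)
  open import Data.List.Membership.Propositional.Properties using (∈-allFin; ∈-filter⁻; ∈-map⁺; ∈-map⁻)
  open import Data.List.Relation.Unary.All using (All; []; _∷_)
  import Data.List.Relation.Unary.All as All
  open import Data.List.Relation.Unary.All.Properties using (all⁺; all⁻; tabulate⁺; tabulate⁻; all-filter)
  open import Data.List.Relation.Unary.Any using (Any; here; there; satisfied)
  open import Data.Nat using (ℕ; zero; suc; _+_; _*_; _∸_; _≤_; _<_; z≤n; s≤s; z<s; _≟_; _<?_; _!; _⊓_; _≡ᵇ_; _<ᵇ_)
  open import Data.Nat.Combinatorics.Base using (_P′_)
  open import Data.Nat.Combinatorics.Specification using (nP′n≡n!)
  open import Data.Nat.ListAction using (sum)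
  open import Data.Nat.ListAction.Properties using (sum-++)
  open import Data.Nat.Properties
  open import Data.Product using (∃; _×_; _,_; proj₁; proj₂)
  open import Data.Sum using (_⊎_; inj₁; inj₂)
  open import Data.Unit using (⊤)
  open import Data.Vec using (Vec; lookup; toList; fromList)
  import Data.Vec as V
  import Data.Vec.Properties as V
  open import Defs
  open import Function using (_∘_; id)
  open import Function.Bundles using (Equivalence)
  open import Function.Definitions using (Injective)
  open import Relation.Binary.Definitions using (DecidableEquality; tri<; tri≈; tri>)
  open import Relation.Binary.PropositionalEquality using (_≡_; _≢_; refl; sym; trans; cong; cong₂; subst; subst₂; module ≡-Reasoning)
  open import Relation.Nullary using (Dec; yes; no; does; ¬_; contradiction)
  open import Relation.Nullary.Decidable using (_×-dec_; _→-dec_; ¬?; map′; dec-true; dec-false; T?)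
  open import Relation.Unary using (Pred; Decidable)
  open import Algebra.Properties.CommutativeSemigroup +-commutativeSemigroup using (interchange)
  open import Algebra.Properties.CommutativeSemigroup ℤ.+-commutativeSemigroup using () renaming (interchange to ℤ-interchange)
  open import Algebra.Properties.Group (AbelianGroup.group ℤ.+-0-abelianGroup) using (∙-cancelʳ)

  private variable
    a p : Level
    A B : Set a
    P Q : Set p
    n N : ℕ

  χᵇ : Bool → ℕ
  χᵇ true  = 1
  χᵇ false = 0

  χ : Dec P → ℕ
  χ d = χᵇ (does d)

  χᵇ-∧ : ∀ b c → χᵇ (b ∧ c) ≡ χᵇ b * χᵇ c
  χᵇ-∧ true  c = sym (+-identityʳ (χᵇ c))
  χᵇ-∧ false c = refl

  χ-yes : (d : Dec P) → P → χ d ≡ 1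
  χ-yes (yes _) _  = refl
  χ-yes (no ¬p) p = contradiction p ¬p

  χ-no : (d : Dec P) → ¬ P → χ d ≡ 0
  χ-no (yes p) ¬p = contradiction p ¬p
  χ-no (no _)  _  = refl

  χ-≤1 : (d : Dec P) → χ d ≤ 1
  χ-≤1 (yes _) = s≤s z≤n
  χ-≤1 (no _)  = z≤n

  does≡true⇒ : (d : Dec P) → does d ≡ true → P
  does≡true⇒ (yes p) _ = p

  χ-pos : (d : Dec P) → 0 < χ d → P
  χ-pos (yes p) _ = p

  χ-mono : (d : Dec P) (e : Dec Q) → (P → Q) → χ d ≤ χ e
  χ-mono (yes p) (yes _) _  = ≤-refl
  χ-mono (yes p) (no ¬q) f = contradiction (f p) ¬q
  χ-mono (no _)  _       _ = z≤n

  χ-cong : (d : Dec P) (e : Dec Q) → (P → Q) → (Q → P) → χ d ≡ χ e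
  χ-cong d e f g = ≤-antisym (χ-mono d e f) (χ-mono e d g)

  χ-× : (d : Dec P) (e : Dec Q) → χ (d ×-dec e) ≡ χ d * χ e
  χ-× d e = χᵇ-∧ (does d) (does e)

  χ-complement : (d : Dec P) (e : Dec Q) → (Q → ¬ P) → (¬ P → Q) → χ d + χ e ≡ 1
  χ-complement (yes p) (yes q) f _ = contradiction p (f q)
  χ-complement (yes _) (no _)  _ _ = refl
  χ-complement (no _)  (yes _) _ _ = refl
  χ-complement (no ¬p) (no ¬q) _ g = contradiction (g ¬p) ¬q

  ∑ : List A → (A → ℕ) → ℕ
  ∑ xs f = sum (map f xs)

  infix 10 ∑
  syntax ∑ xs (λ x → e) = ∑[ x ∈ xs ] e

  ∑-cong : (xs : List A) {f g : A → ℕ} → (∀ x → f x ≡ g x) → ∑ xs f ≡ ∑ xs g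
  ∑-cong xs eq = cong sum (map-cong eq xs)

  ∑-++ : (xs ys : List A) (f : A → ℕ) → ∑ (xs ++ ys) f ≡ ∑ xs f + ∑ ys f
  ∑-++ xs ys f = trans (cong sum (map-++ f xs ys)) (sum-++ (map f xs) (map f ys))

  ∑-map : (g : A → B) (xs : List A) (f : B → ℕ) → ∑ (map g xs) f ≡ ∑[ x ∈ xs ] f (g x)
  ∑-map g []       f = refl
  ∑-map g (x ∷ xs) f = cong (f (g x) +_) (∑-map g xs f)

  ∑-concatMap : (g : A → List B) (xs : List A) (f : B → ℕ) →
                ∑ (concatMap g xs) f ≡ ∑[ x ∈ xs ] ∑ (g x) f
  ∑-concatMap g []       f = refl
  ∑-concatMap g (x ∷ xs) f =
    trans (∑-++ (g x) (concatMap g xs) f) (cong (∑ (g x) f +_) (∑-concatMap g xs f))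

  ∑-zero : (xs : List A) {f : A → ℕ} → (∀ x → f x ≡ 0) → ∑ xs f ≡ 0
  ∑-zero []       eq = refl
  ∑-zero (x ∷ xs) eq = cong₂ _+_ (eq x) (∑-zero xs eq)

  ∑-+ : (xs : List A) (f g : A → ℕ) → ∑[ x ∈ xs ] (f x + g x) ≡ ∑ xs f + ∑ xs g
  ∑-+ []       f g = refl
  ∑-+ (x ∷ xs) f g = trans (cong (f x + g x +_) (∑-+ xs f g)) (interchange (f x) (g x) (∑ xs f) (∑ xs g))

  ∑-*ʳ : (xs : List A) (f : A → ℕ) (c : ℕ) → ∑[ x ∈ xs ] (f x * c) ≡ ∑ xs f * c
  ∑-*ʳ []       f c = refl
  ∑-*ʳ (x ∷ xs) f c = trans (cong (f x * c +_) (∑-*ʳ xs f c)) (sym (*-distribʳ-+ c (f x) (∑ xs f)))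

  ∑-*ˡ : (xs : List A) (f : A → ℕ) (c : ℕ) → ∑[ x ∈ xs ] (c * f x) ≡ c * ∑ xs f
  ∑-*ˡ xs f c = trans (∑-cong xs (λ x → *-comm c (f x))) (trans (∑-*ʳ xs f c) (*-comm (∑ xs f) c))

  ∑-comm : (xs : List A) (ys : List B) (f : A → B → ℕ) →
           ∑[ x ∈ xs ] ∑[ y ∈ ys ] f x y ≡ ∑[ y ∈ ys ] ∑[ x ∈ xs ] f x y
  ∑-comm []       ys f = sym (∑-zero ys (λ _ → refl))
  ∑-comm (x ∷ xs) ys f =
    trans (cong (∑ ys (f x) +_) (∑-comm xs ys f)) (sym (∑-+ ys (f x) (λ y → ∑[ x′ ∈ xs ] f x′ y)))

  ∑-const : (xs : List A) (c : ℕ) → ∑[ x ∈ xs ] c ≡ length xs * c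
  ∑-const []       c = refl
  ∑-const (x ∷ xs) c = cong (c +_) (∑-const xs c)

  ∑-mono-≤ : (xs : List A) {f g : A → ℕ} → (∀ x → f x ≤ g x) → ∑ xs f ≤ ∑ xs g
  ∑-mono-≤ []       le = z≤n
  ∑-mono-≤ (x ∷ xs) le = +-mono-≤ (le x) (∑-mono-≤ xs le)

  ∑-mono-< : {xs : List A} {f g : A → ℕ} → (∀ x → f x ≤ g x) → ∀ {y} → y ∈ xs → f y < g y → ∑ xs f < ∑ xs g
  ∑-mono-< {xs = x ∷ xs} le (here refl) lt = +-mono-<-≤ lt (∑-mono-≤ xs le)
  ∑-mono-< {xs = x ∷ xs} le (there y∈xs) lt = +-mono-≤-< (le x) (∑-mono-< le y∈xs lt)

  length-filter-∑ : {P : Pred A p} (P? : Decidable P) (xs : List A) → length (filter P? xs) ≡ ∑[ x ∈ xs ] χ (P? x)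
  length-filter-∑ P? []       = refl
  length-filter-∑ P? (x ∷ xs) with P? x
  ... | yes _ = cong suc (length-filter-∑ P? xs)
  ... | no  _ = length-filter-∑ P? xs

  ∑-filter : {P : Pred A p} (P? : Decidable P) (xs : List A) (f : A → ℕ) →
             ∑ (filter P? xs) f ≡ ∑[ x ∈ xs ] (χ (P? x) * f x)
  ∑-filter P? []       f = refl
  ∑-filter P? (x ∷ xs) f with P? x
  ... | yes _ = cong₂ _+_ (sym (+-identityʳ (f x))) (∑-filter P? xs f)
  ... | no  _ = ∑-filter P? xs f

  module _ {P : Pred A p} (P? : Decidable P) where

    ∑-χ-none : (xs : List A) → (∀ x → ¬ P x) → ∑[ x ∈ xs ] χ (P? x) ≡ 0
    ∑-χ-none xs none = ∑-zero xs (λ x → χ-no (P? x) (none x))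

    ∑-χ-pos⇒any : (xs : List A) → 0 < ∑[ x ∈ xs ] χ (P? x) → Any P xs
    ∑-χ-pos⇒any (x ∷ xs) pos with P? x
    ... | yes px = here px
    ... | no  _  = there (∑-χ-pos⇒any xs pos)

  record Enumerates {A : Set a} (_≟ₐ_ : DecidableEquality A) (xs : List A) : Set a where
    field occursOnce : ∀ x → ∑[ y ∈ xs ] χ (x ≟ₐ y) ≡ 1

  open Enumerates public

  ∑-δ-count : (_≟ₐ_ : DecidableEquality A) (xs : List A) (w : A) (g : A → ℕ) →
              ∑[ x ∈ xs ] (χ (w ≟ₐ x) * g x) ≡ ∑[ x ∈ xs ] χ (w ≟ₐ x) * g w
  ∑-δ-count _≟ₐ_ xs w g = trans (∑-cong xs pointwise) (∑-*ʳ xs _ (g w))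
    where
    pointwise : ∀ x → χ (w ≟ₐ x) * g x ≡ χ (w ≟ₐ x) * g w
    pointwise x with w ≟ₐ x
    ... | yes refl = refl
    ... | no  _    = refl

  module _ {_≟ₐ_ : DecidableEquality A} {xs : List A} (enum : Enumerates _≟ₐ_ xs) where

    ∑-δ : (w : A) (g : A → ℕ) → ∑[ x ∈ xs ] (χ (w ≟ₐ x) * g x) ≡ g w
    ∑-δ w g = trans (∑-δ-count _≟ₐ_ xs w g) (trans (cong (_* g w) (enum .occursOnce w)) (*-identityˡ (g w)))

    module _ {P : Pred A p} (P? : Decidable P) where

      ∑-χ-unique : ∀ {w} → P w → (∀ v → P v → v ≡ w) → ∑[ x ∈ xs ] χ (P? x) ≡ 1
      ∑-χ-unique {w} pw unique =
        trans (∑-cong xs (λ x → χ-cong (P? x) (w ≟ₐ x) (λ px → sym (unique x px)) (λ { refl → pw }))) (enum .occursOnce w)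

      ∑-χ≡1⇒unique : ∑[ x ∈ xs ] χ (P? x) ≡ 1 → ∀ {v w} → P v → P w → v ≡ w
      ∑-χ≡1⇒unique one {v} {w} pv pw with v ≟ₐ w
      ... | yes v≡w = v≡w
      ... | no  v≢w = contradiction (≤-trans two (≤-reflexive one)) λ { (s≤s ()) }
        where
        both : ∀ x → χ (v ≟ₐ x) + χ (w ≟ₐ x) ≤ χ (P? x)
        both x with v ≟ₐ x | w ≟ₐ x
        ... | yes refl | yes refl = contradiction refl v≢w
        ... | yes refl | no  _    = ≤-reflexive (sym (χ-yes (P? x) pv))
        ... | no  _    | yes refl = ≤-reflexive (sym (χ-yes (P? x) pw))
        ... | no  _    | no  _    = z≤n
        two : 2 ≤ ∑[ x ∈ xs ] χ (P? x)
        two = subst (_≤ ∑[ x ∈ xs ] χ (P? x))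
                    (trans (∑-+ xs _ _) (cong₂ _+_ (enum .occursOnce v) (enum .occursOnce w)))
                    (∑-mono-≤ xs both)

  lookup-extensionality : ∀ {n} {v w : Vec A n} → (∀ i → lookup v i ≡ lookup w i) → v ≡ w
  lookup-extensionality {v = v} {w} eq =
    trans (sym (V.tabulate∘lookup v)) (trans (V.tabulate-cong eq) (V.tabulate∘lookup w))

  ∑-allFin-suc : ∀ {n} (f : Fin (suc n) → ℕ) → ∑[ i ∈ allFin (suc n) ] f i ≡ f zero + ∑[ i ∈ allFin n ] f (suc i)
  ∑-allFin-suc f = cong (λ xs → f zero + sum xs) (trans (map-tabulate suc f) (sym (map-tabulate id (f ∘ suc))))

  allFin-occursOnce : ∀ {n} (j : Fin n) → ∑[ i ∈ allFin n ] χ (j Fin.≟ i) ≡ 1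
  allFin-occursOnce {suc n} zero    = trans (∑-allFin-suc {n} (λ i → χ (zero Fin.≟ i))) (cong suc (∑-zero (allFin n) (λ _ → refl)))
  allFin-occursOnce {suc n} (suc j) = trans (∑-allFin-suc {n} (λ i → χ (suc j Fin.≟ i))) (allFin-occursOnce j)

  allFin-enumerates : ∀ {n} → Enumerates Fin._≟_ (allFin n)
  allFin-enumerates .occursOnce = allFin-occursOnce

  ∑-allFin-< : ∀ {n} k → k ≤ n → ∑[ i ∈ allFin n ] χ (toℕ i <? k) ≡ k
  ∑-allFin-< {n} zero _ = ∑-χ-none (λ i → toℕ i <? 0) (allFin n) (λ i ())
  ∑-allFin-< {suc n} (suc k) (s≤s k≤n) = trans (∑-allFin-suc {n} (λ i → χ (toℕ i <? suc k))) (cong suc (∑-allFin-< k k≤n))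

  ∑-toList : ∀ {n} (h : Vec A n) (g : A → ℕ) → ∑ (toList h) g ≡ ∑[ e ∈ allFin n ] g (lookup h e)
  ∑-toList V.[]      g = refl
  ∑-toList {n = suc n} (x V.∷ h) g = trans (cong (g x +_) (∑-toList h g)) (sym (∑-allFin-suc {n} (λ e → g (lookup (x V.∷ h) e))))

  module _ {_≟ₐ_ : DecidableEquality A} {xs : List A} (enum-xs : Enumerates _≟ₐ_ xs) where

    consAll-enumerates : ∀ {n} {vs : List (Vec A n)} → Enumerates (V.≡-dec _≟ₐ_) vs →
                         Enumerates (V.≡-dec _≟ₐ_) (concatMap (λ v → map (V._∷ v) xs) vs)
    consAll-enumerates {vs = vs} enum-vs .occursOnce (x V.∷ v) = begin
      ∑ (concatMap (λ u → map (V._∷ u) xs) vs) (λ w → χ (V.≡-dec _≟ₐ_ (x V.∷ v) w))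
        ≡⟨ ∑-concatMap _ vs _ ⟩
      ∑[ u ∈ vs ] ∑ (map (V._∷ u) xs) (λ w → χ (V.≡-dec _≟ₐ_ (x V.∷ v) w))
        ≡⟨ ∑-cong vs (λ u → trans (∑-map _ xs _) (∑-cong xs (λ y → χᵇ-∧ (does (x ≟ₐ y)) _))) ⟩
      ∑[ u ∈ vs ] ∑[ y ∈ xs ] (χ (x ≟ₐ y) * χ (V.≡-dec _≟ₐ_ v u))
        ≡⟨ ∑-cong vs (λ u → ∑-*ʳ xs _ _) ⟩
      ∑[ u ∈ vs ] (∑[ y ∈ xs ] χ (x ≟ₐ y) * χ (V.≡-dec _≟ₐ_ v u))
        ≡⟨ ∑-cong vs (λ u → trans (cong (_* _) (enum-xs .occursOnce x)) (*-identityˡ _)) ⟩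
      ∑[ u ∈ vs ] χ (V.≡-dec _≟ₐ_ v u)
        ≡⟨ enum-vs .occursOnce v ⟩
      1 ∎
      where open ≡-Reasoning

  allFuns-enumerates : ∀ N n → Enumerates (V.≡-dec Fin._≟_) (allFuns N n)
  allFuns-enumerates N zero    .occursOnce V.[] = refl
  allFuns-enumerates N (suc n)      =
    consAll-enumerates {_≟ₐ_ = Fin._≟_} allFin-enumerates {vs = allFuns N n} (allFuns-enumerates N n)

  allSubsets-enumerates : ∀ n → Enumerates (V.≡-dec Bool._≟_) (allSubsets n)
  allSubsets-enumerates zero    .occursOnce V.[] = refl
  allSubsets-enumerates (suc n)      =
    consAll-enumerates {_≟ₐ_ = Bool._≟_} bool-enumerates {vs = allSubsets n} (allSubsets-enumerates n)
    where
    bool-enumerates : Enumerates Bool._≟_ (outside ∷ inside ∷ [])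
    bool-enumerates .occursOnce false = refl
    bool-enumerates .occursOnce true  = refl

  ∑-allFuns-suc : ∀ N n (f : Vec (Fin N) (suc n) → ℕ) →
                  ∑ (allFuns N (suc n)) f ≡ ∑[ v ∈ allFuns N n ] ∑[ i ∈ allFin N ] f (i V.∷ v)
  ∑-allFuns-suc N n f = trans (∑-concatMap _ (allFuns N n) f) (∑-cong (allFuns N n) (λ v → ∑-map _ (allFin N) f))

  ∑-allFin-const : ∀ n c → ∑[ i ∈ allFin n ] c ≡ n * c
  ∑-allFin-const n c = trans (∑-const (allFin n) c) (cong (_* c) (length-tabulate {n = n} id))

  ∑-≤1-≡length⇒≡1 : {xs : List A} {g : A → ℕ} → (∀ x → g x ≤ 1) → ∑ xs g ≡ length xs →
                     ∀ {x} → x ∈ xs → g x ≡ 1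
  ∑-≤1-≡length⇒≡1 {xs = xs} {g} ≤1 total {x} x∈xs =
    ≤-antisym (≤1 x) (≮⇒≥ λ gx<1 → <-irrefl total (<-≤-trans (∑-mono-< ≤1 x∈xs gx<1) (≤-reflexive length-as-∑)))
    where
    length-as-∑ : ∑[ y ∈ xs ] 1 ≡ length xs
    length-as-∑ = trans (∑-const xs 1) (*-identityʳ (length xs))

  injective? : (f : Fin n → Fin N) → Dec (Injective _≡_ _≡_ f)
  injective? f = map′ (λ inj {x} {y} → inj x y) (λ inj x y → inj)
    (Fin.all? λ x → Fin.all? λ y → (f x Fin.≟ f y) →-dec (x Fin.≟ y))

  ∑-fibres : (f : Fin n → Fin N) → ∑[ i ∈ allFin N ] ∑[ e ∈ allFin n ] χ (f e Fin.≟ i) ≡ n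
  ∑-fibres {n} {N} f = begin
    ∑[ i ∈ allFin N ] ∑[ e ∈ allFin n ] χ (f e Fin.≟ i) ≡⟨ ∑-comm (allFin N) (allFin n) _ ⟩
    ∑[ e ∈ allFin n ] ∑[ i ∈ allFin N ] χ (f e Fin.≟ i) ≡⟨ ∑-cong (allFin n) (λ e → allFin-occursOnce (f e)) ⟩
    ∑[ e ∈ allFin n ] 1                                 ≡⟨ ∑-allFin-const n 1 ⟩
    n * 1                                               ≡⟨ *-identityʳ n ⟩
    n                                                   ∎
    where open ≡-Reasoning

  inImage? : (f : Fin n → Fin N) (i : Fin N) → Dec (∃ λ e → f e ≡ i)
  inImage? f i = Fin.any? (λ e → f e Fin.≟ i)

  OutsideImage : (Fin n → Fin N) → Fin N → Set
  OutsideImage f i = ∀ e → f e ≢ i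

  outsideImage? : (f : Fin n → Fin N) (i : Fin N) → Dec (OutsideImage f i)
  outsideImage? f i = Fin.all? (λ e → ¬? (f e Fin.≟ i))

  module _ {f : Fin n → Fin N} (inj : Injective _≡_ _≡_ f) where

    fibre≡χ-inImage : ∀ i → ∑[ e ∈ allFin n ] χ (f e Fin.≟ i) ≡ χ (inImage? f i)
    fibre≡χ-inImage i with inImage? f i
    ... | yes (e , fe≡i) = ∑-χ-unique allFin-enumerates (λ e → f e Fin.≟ i) fe≡i
                             (λ e′ fe′≡i → inj (trans fe′≡i (sym fe≡i)))
    ... | no  ∄e         = ∑-χ-none (λ e → f e Fin.≟ i) (allFin n) (λ e fe≡i → ∄e (e , fe≡i))

    ∑-outsideImage : ∑[ i ∈ allFin N ] χ (outsideImage? f i) ≡ N ∸ n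
    ∑-outsideImage = sym (begin
      N ∸ n                                           ≡⟨ cong (_∸ n) total ⟨
      ∑[ i ∈ allFin N ] χ (inImage? f i) + #outside ∸ n ≡⟨ cong (λ m → m + #outside ∸ n) #inImage ⟩
      n + #outside ∸ n                                 ≡⟨ m+n∸m≡n n #outside ⟩
      #outside                                        ∎)
      where
      open ≡-Reasoning
      #outside = ∑[ i ∈ allFin N ] χ (outsideImage? f i)
      #inImage : ∑[ i ∈ allFin N ] χ (inImage? f i) ≡ n
      #inImage = trans (∑-cong (allFin N) (λ i → sym (fibre≡χ-inImage i))) (∑-fibres f)
      total : ∑[ i ∈ allFin N ] χ (inImage? f i) + #outside ≡ N
      total = begin
        ∑[ i ∈ allFin N ] χ (inImage? f i) + #outside
          ≡⟨ ∑-+ (allFin N) _ _ ⟨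
        ∑[ i ∈ allFin N ] (χ (inImage? f i) + χ (outsideImage? f i))
          ≡⟨ ∑-cong (allFin N) (λ i → χ-complement (inImage? f i) (outsideImage? f i)
                                        (λ out (e , fe≡i) → out e fe≡i) (λ ∄e e fe≡i → ∄e (e , fe≡i))) ⟩
        ∑[ i ∈ allFin N ] 1
          ≡⟨ trans (∑-allFin-const N 1) (*-identityʳ N) ⟩
        N ∎

  module _ {f : Fin n → Fin n} (inj : Injective _≡_ _≡_ f) where

    injective⇒fibre≡1 : ∀ i → ∑[ e ∈ allFin n ] χ (f e Fin.≟ i) ≡ 1
    injective⇒fibre≡1 i = ∑-≤1-≡length⇒≡1 fibre-≤1 (trans (∑-fibres f) (sym (length-tabulate id))) (∈-allFin i)
      where
      fibre-≤1 : ∀ i → ∑[ e ∈ allFin n ] χ (f e Fin.≟ i) ≤ 1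
      fibre-≤1 i = subst (_≤ 1) (sym (fibre≡χ-inImage inj i)) (χ-≤1 (inImage? f i))

    injective⇒surjective : ∀ i → ∃ λ e → f e ≡ i
    injective⇒surjective i =
      satisfied (∑-χ-pos⇒any (λ e → f e Fin.≟ i) (allFin n) (≤-reflexive (sym (injective⇒fibre≡1 i))))

    injective-count-< : ∀ k → k ≤ n → ∑[ e ∈ allFin n ] χ (toℕ (f e) <? k) ≡ k
    injective-count-< k k≤n = begin
      ∑[ e ∈ allFin n ] χ (toℕ (f e) <? k)
        ≡⟨ ∑-cong (allFin n) (λ e → ∑-δ allFin-enumerates (f e) (λ i → χ (toℕ i <? k))) ⟨
      ∑[ e ∈ allFin n ] ∑[ i ∈ allFin n ] (χ (f e Fin.≟ i) * χ (toℕ i <? k))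
        ≡⟨ ∑-comm (allFin n) (allFin n) _ ⟩
      ∑[ i ∈ allFin n ] ∑[ e ∈ allFin n ] (χ (f e Fin.≟ i) * χ (toℕ i <? k))
        ≡⟨ ∑-cong (allFin n) (λ i → ∑-*ʳ (allFin n) _ _) ⟩
      ∑[ i ∈ allFin n ] (∑[ e ∈ allFin n ] χ (f e Fin.≟ i) * χ (toℕ i <? k))
        ≡⟨ ∑-cong (allFin n) (λ i → trans (cong (_* _) (injective⇒fibre≡1 i)) (*-identityˡ _)) ⟩
      ∑[ i ∈ allFin n ] χ (toℕ i <? k)
        ≡⟨ ∑-allFin-< k k≤n ⟩
      k ∎
      where open ≡-Reasoning

  module _ {i : Fin N} {v : Vec (Fin N) n} where

    injective-∷⁻ : Injective _≡_ _≡_ (lookup (i V.∷ v)) → Injective _≡_ _≡_ (lookup v) × OutsideImage (lookup v) i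
    injective-∷⁻ inj = (λ eq → Fin.suc-injective (inj eq)) , (λ e eq → contradiction (inj {suc e} {zero} eq) λ ())

    injective-∷⁺ : Injective _≡_ _≡_ (lookup v) → OutsideImage (lookup v) i → Injective _≡_ _≡_ (lookup (i V.∷ v))
    injective-∷⁺ inj out {zero}  {zero}  eq = refl
    injective-∷⁺ inj out {zero}  {suc e} eq = contradiction (sym eq) (out e)
    injective-∷⁺ inj out {suc e} {zero}  eq = contradiction eq (out e)
    injective-∷⁺ inj out {suc e} {suc _} eq = cong suc (inj eq)

  ∑-injective-∷ : (v : Vec (Fin N) n) →
                  ∑[ i ∈ allFin N ] χ (injective? (lookup (i V.∷ v))) ≡ χ (injective? (lookup v)) * (N ∸ n)
  ∑-injective-∷ {N} {n} v with injective? (lookup v)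
  ... | no ¬inj = begin
    ∑[ i ∈ allFin N ] χ (injective? (lookup (i V.∷ v)))
      ≡⟨ ∑-χ-none (λ i → injective? (lookup (i V.∷ v))) (allFin N) (λ i inj → ¬inj (proj₁ (injective-∷⁻ inj))) ⟩
    0 * (N ∸ n)
      ≡⟨ cong (_* (N ∸ n)) (χ-no (injective? (lookup v)) ¬inj) ⟨
    χ (injective? (lookup v)) * (N ∸ n) ∎
    where open ≡-Reasoning
  ... | yes inj = begin
    ∑[ i ∈ allFin N ] χ (injective? (lookup (i V.∷ v)))
      ≡⟨ ∑-cong (allFin N) (λ i → χ-cong (injective? _) (outsideImage? (lookup v) i)
                                    (proj₂ ∘ injective-∷⁻) (injective-∷⁺ inj)) ⟩
    ∑[ i ∈ allFin N ] χ (outsideImage? (lookup v) i)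
      ≡⟨ ∑-outsideImage inj ⟩
    N ∸ n
      ≡⟨ +-identityʳ (N ∸ n) ⟨
    1 * (N ∸ n)
      ≡⟨ cong (_* (N ∸ n)) (χ-yes (injective? (lookup v)) inj) ⟨
    χ (injective? (lookup v)) * (N ∸ n) ∎
    where open ≡-Reasoning

  count-injective : ∀ N n → ∑[ v ∈ allFuns N n ] χ (injective? (lookup v)) ≡ N P′ n
  count-injective N zero    = refl
  count-injective N (suc n) = begin
    ∑[ v ∈ allFuns N (suc n) ] χ (injective? (lookup v))
      ≡⟨ ∑-allFuns-suc N n _ ⟩
    ∑[ v ∈ allFuns N n ] ∑[ i ∈ allFin N ] χ (injective? (lookup (i V.∷ v)))
      ≡⟨ ∑-cong (allFuns N n) ∑-injective-∷ ⟩
    ∑[ v ∈ allFuns N n ] (χ (injective? (lookup v)) * (N ∸ n))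
      ≡⟨ ∑-*ʳ (allFuns N n) _ (N ∸ n) ⟩
    ∑[ v ∈ allFuns N n ] χ (injective? (lookup v)) * (N ∸ n)
      ≡⟨ cong (_* (N ∸ n)) (count-injective N n) ⟩
    (N P′ n) * (N ∸ n)
      ≡⟨ *-comm (N P′ n) (N ∸ n) ⟩
    N P′ suc n ∎
    where open ≡-Reasoning

  fiber-∑ : (h : Vec (Fin N) n) (i : Fin N) → fiber h i ≡ ∑[ e ∈ allFin n ] χ (lookup h e Fin.≟ i)
  fiber-∑ h i = trans (length-filter-∑ (Fin._≟ i) (toList h)) (∑-toList h (λ j → χ (j Fin.≟ i)))

  HasExponent : Vec (Fin N) n → Vec ℕ N → Set
  HasExponent h a = ∀ i → fiber h i ≡ lookup a i

  hasExponent? : (h : Vec (Fin N) n) (a : Vec ℕ N) → Dec (HasExponent h a)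
  hasExponent? h a = Fin.all? (λ i → fiber h i ≟ lookup a i)

  χᵇ-hasExponent : (h : Vec (Fin N) n) (a : Vec ℕ N) → χᵇ (hasExponent h a) ≡ χ (hasExponent? h a)
  χᵇ-hasExponent {N} h a = χ-cong (T? (hasExponent h a)) (hasExponent? h a)
    (λ t i → ≡ᵇ⇒≡ _ _ (tabulate⁻ (all⁺ _ (allFin N) t) i))
    (λ he → all⁻ _ (tabulate⁺ (λ i → ≡⇒≡ᵇ _ _ (he i))))

  χ-≟true : ∀ b → χ (b Bool.≟ true) ≡ χᵇ b
  χ-≟true true  = refl
  χ-≟true false = refl

  coeffF-∑ : (M : Matroid n) (a : Vec ℕ N) →
             coeffF M a ≡ ∑[ h ∈ allFuns N n ] (χᵇ (isGeneric M (asPos h)) * χ (hasExponent? h a))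
  coeffF-∑ {n} {N} M a = trans (length-filter-∑ _ (allFuns N n)) (∑-cong (allFuns N n) conjunction)
    where
    conjunction : ∀ h → χ (isGeneric M (asPos h) ∧ hasExponent h a Bool.≟ true) ≡
                        χᵇ (isGeneric M (asPos h)) * χ (hasExponent? h a)
    conjunction h with isGeneric M (asPos h)
    ... | true  = trans (χ-≟true (hasExponent h a)) (trans (χᵇ-hasExponent h a) (sym (+-identityʳ _)))
    ... | false = refl

  hasExponent-ones⇔injective : (h : Vec (Fin n) n) →
    (HasExponent h (V.replicate n 1) → Injective _≡_ _≡_ (lookup h)) ×
    (Injective _≡_ _≡_ (lookup h) → HasExponent h (V.replicate n 1))
  hasExponent-ones⇔injective {n} h = to , from
    where
    fibre≡1 : HasExponent h (V.replicate n 1) → ∀ i → ∑[ e ∈ allFin n ] χ (lookup h e Fin.≟ i) ≡ 1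
    fibre≡1 he i = trans (sym (fiber-∑ h i)) (trans (he i) (V.lookup-replicate i 1))
    to : HasExponent h (V.replicate n 1) → Injective _≡_ _≡_ (lookup h)
    to he {e} {e′} eq = ∑-χ≡1⇒unique allFin-enumerates (λ e″ → lookup h e″ Fin.≟ lookup h e)
                          (fibre≡1 he (lookup h e)) refl (sym eq)
    from : Injective _≡_ _≡_ (lookup h) → HasExponent h (V.replicate n 1)
    from inj i = trans (fiber-∑ h i) (trans (injective⇒fibre≡1 inj i) (sym (V.lookup-replicate i 1)))

  infix 4 _≟ˢ_
  _≟ˢ_ : DecidableEquality (Subset n)
  _≟ˢ_ = V.≡-dec Bool._≟_

  true≢false : true ≢ false
  true≢false ()

  lookup-⁅⁆ : (x e : Fin n) → lookup Subset.⁅ x ⁆ e ≡ does (x Fin.≟ e)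
  lookup-⁅⁆ zero    zero    = refl
  lookup-⁅⁆ zero    (suc e) = V.lookup-replicate e outside
  lookup-⁅⁆ (suc x) zero    = refl
  lookup-⁅⁆ (suc x) (suc e) = lookup-⁅⁆ x e

  does-∈? : (e : Fin n) (B : Subset n) → does (e Subset.∈? B) ≡ lookup B e
  does-∈? zero    (true  V.∷ B) = refl
  does-∈? zero    (false V.∷ B) = refl
  does-∈? (suc e) (b V.∷ B)     = does-∈? e B

  lookup-remove : (B : Subset n) (x e : Fin n) → lookup (B Subset.- x) e ≡ lookup B e ∧ not (does (x Fin.≟ e))
  lookup-remove (b V.∷ B) zero    zero    = sym (Bool.∧-zeroʳ b)
  lookup-remove (b V.∷ B) zero    (suc e) = trans (cong (λ p → lookup p e) (Subset.p─⊥≡p B)) (sym (Bool.∧-identityʳ _))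
  lookup-remove (b V.∷ B) (suc x) zero    = sym (Bool.∧-identityʳ b)
  lookup-remove (b V.∷ B) (suc x) (suc e) = lookup-remove B x e

  _[_⇄_] : Subset n → Fin n → Fin n → Subset n
  B [ x ⇄ y ] = (B Subset.- x) Subset.∪ Subset.⁅ y ⁆

  lookup-⇄ : (B : Subset n) (x y e : Fin n) →
             lookup (B [ x ⇄ y ]) e ≡ (lookup B e ∧ not (does (x Fin.≟ e))) ∨ does (y Fin.≟ e)
  lookup-⇄ B x y e = trans (V.lookup-zipWith _∨_ e (B Subset.- x) Subset.⁅ y ⁆)
                           (cong₂ _∨_ (lookup-remove B x e) (lookup-⁅⁆ y e))

  module _ (B : Subset n) (x y : Fin n) where

    lookup-⇄-new : lookup (B [ x ⇄ y ]) y ≡ true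
    lookup-⇄-new rewrite lookup-⇄ B x y y | dec-true (y Fin.≟ y) refl = Bool.∨-zeroʳ _

    lookup-⇄-old : x ≢ y → lookup (B [ x ⇄ y ]) x ≡ false
    lookup-⇄-old x≢y rewrite lookup-⇄ B x y x | dec-true (x Fin.≟ x) refl | dec-false (y Fin.≟ x) (x≢y ∘ sym) =
      trans (Bool.∨-identityʳ _) (Bool.∧-zeroʳ _)

    lookup-⇄-other : ∀ {e} → x ≢ e → y ≢ e → lookup (B [ x ⇄ y ]) e ≡ lookup B e
    lookup-⇄-other {e} x≢e y≢e rewrite lookup-⇄ B x y e | dec-false (x Fin.≟ e) x≢e | dec-false (y Fin.≟ e) y≢e =
      trans (Bool.∨-identityʳ _) (Bool.∧-identityʳ _)

    lookup-⇄-kept : ∀ {e} → lookup B e ≡ true → x ≢ e → lookup (B [ x ⇄ y ]) e ≡ true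
    lookup-⇄-kept {e} e∈B x≢e with y Fin.≟ e
    ... | yes refl = lookup-⇄-new
    ... | no  y≢e  = trans (lookup-⇄-other x≢e y≢e) e∈B

  ⇄-⇄ : (B : Subset n) {x y : Fin n} → lookup B x ≡ true → lookup B y ≡ false → (B [ x ⇄ y ]) [ y ⇄ x ] ≡ B
  ⇄-⇄ B {x} {y} x∈B y∉B = lookup-extensionality pointwise
    where
    x≢y : x ≢ y
    x≢y refl = true≢false (trans (sym x∈B) y∉B)
    pointwise : ∀ i → lookup ((B [ x ⇄ y ]) [ y ⇄ x ]) i ≡ lookup B i
    pointwise i with x Fin.≟ i | y Fin.≟ i
    ... | yes refl | _        = trans (lookup-⇄-new (B [ i ⇄ y ]) y i) (sym x∈B)
    ... | no  _    | yes refl = trans (lookup-⇄-old (B [ x ⇄ i ]) i x (x≢y ∘ sym)) (sym y∉B)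
    ... | no  x≢i  | no  y≢i  = trans (lookup-⇄-other (B [ x ⇄ y ]) y x y≢i x≢i) (lookup-⇄-other B x y x≢i y≢i)

  weight-lookup : (f : Fin n → ℕ) (B : Subset n) → weight f B ≡ ∑[ e ∈ allFin n ] (if lookup B e then f e else 0)
  weight-lookup {n} f B = ∑-cong (allFin n) (λ e → cong (λ b → if b then f e else 0) (does-∈? e B))

  weight-⇄ : (f : Fin n → ℕ) {B : Subset n} {x y : Fin n} → lookup B x ≡ true → lookup B y ≡ false →
             weight f (B [ x ⇄ y ]) + f x ≡ weight f B + f y
  weight-⇄ {n} f {B} {x} {y} x∈B y∉B = begin
    weight f (B [ x ⇄ y ]) + f x
      ≡⟨ cong₂ _+_ (weight-lookup f (B [ x ⇄ y ])) (sym (∑-δ allFin-enumerates x f)) ⟩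
    ∑[ e ∈ allFin n ] (if lookup (B [ x ⇄ y ]) e then f e else 0) + ∑[ e ∈ allFin n ] (χ (x Fin.≟ e) * f e)
      ≡⟨ ∑-+ (allFin n) _ _ ⟨
    ∑[ e ∈ allFin n ] ((if lookup (B [ x ⇄ y ]) e then f e else 0) + χ (x Fin.≟ e) * f e)
      ≡⟨ ∑-cong (allFin n) pointwise ⟩
    ∑[ e ∈ allFin n ] ((if lookup B e then f e else 0) + χ (y Fin.≟ e) * f e)
      ≡⟨ ∑-+ (allFin n) _ _ ⟩
    ∑[ e ∈ allFin n ] (if lookup B e then f e else 0) + ∑[ e ∈ allFin n ] (χ (y Fin.≟ e) * f e)
      ≡⟨ cong₂ _+_ (sym (weight-lookup f B)) (∑-δ allFin-enumerates y f) ⟩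
    weight f B + f y ∎
    where
    open ≡-Reasoning
    x≢y : x ≢ y
    x≢y refl = true≢false (trans (sym x∈B) y∉B)
    pointwise : ∀ e → (if lookup (B [ x ⇄ y ]) e then f e else 0) + χ (x Fin.≟ e) * f e ≡
                      (if lookup B e then f e else 0) + χ (y Fin.≟ e) * f e
    pointwise e with x Fin.≟ e | y Fin.≟ e
    ... | yes refl | yes refl = contradiction refl x≢y
    ... | yes refl | no  _    rewrite lookup-⇄-old B x y x≢y | x∈B = refl
    ... | no  _    | yes refl rewrite lookup-⇄-new B x y | y∉B = refl
    ... | no  x≢e  | no  y≢e  rewrite lookup-⇄-other B x y x≢e y≢e = refl

  ∣_∖_∣ : Subset n → Subset n → ℕ
  ∣_∖_∣ {n} B C = ∑[ e ∈ allFin n ] χᵇ (lookup B e ∧ not (lookup C e))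

  ∣⇄∖∣-< : (B C : Subset n) {z w : Fin n} → lookup B z ≡ true → lookup C z ≡ false → lookup C w ≡ true →
           ∣ B [ z ⇄ w ] ∖ C ∣ < ∣ B ∖ C ∣
  ∣⇄∖∣-< B C {z} {w} z∈B z∉C w∈C = ∑-mono-< pointwise (∈-allFin z) strict
    where
    z≢w : z ≢ w
    z≢w refl = true≢false (trans (sym w∈C) z∉C)
    pointwise : ∀ e → χᵇ (lookup (B [ z ⇄ w ]) e ∧ not (lookup C e)) ≤ χᵇ (lookup B e ∧ not (lookup C e))
    pointwise e with z Fin.≟ e | w Fin.≟ e
    ... | yes refl | _        rewrite lookup-⇄-old B z w z≢w = z≤n
    ... | no  _    | yes refl rewrite w∈C | Bool.∧-zeroʳ (lookup (B [ z ⇄ e ]) e) = z≤n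
    ... | no  z≢e  | no  w≢e  rewrite lookup-⇄-other B z w z≢e w≢e = ≤-refl
    strict : χᵇ (lookup (B [ z ⇄ w ]) z ∧ not (lookup C z)) < χᵇ (lookup B z ∧ not (lookup C z))
    strict rewrite lookup-⇄-old B z w z≢w | z∈B | z∉C = s≤s z≤n

  balance-< : ∀ {a b c d} → a + c ≡ b + d → d < c → a < b
  balance-< {a} {b} {c} {d} eq d<c = +-cancelʳ-< c a b (subst (_< b + c) (sym eq) (+-monoʳ-< b d<c))

  balance-≤ : ∀ {a b c d} → a + c ≡ b + d → d ≤ c → a ≤ b
  balance-≤ {a} {b} {c} {d} eq d≤c = +-cancelʳ-≤ c a b (subst (_≤ b + c) (sym eq) (+-monoʳ-≤ b d≤c))

  minimiser : ∀ {p} {P : Pred (Fin n) p} → Decidable P → (f : Fin n → ℕ) → ∃ P →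
              ∃ λ e → P e × (∀ e′ → P e′ → f e ≤ f e′)
  minimiser {P = P} P? f (j , pj) = descend (suc (f j)) j pj ≤-refl
    where
    descend : ∀ bound j → P j → f j < bound → ∃ λ e → P e × (∀ e′ → P e′ → f e ≤ f e′)
    descend (suc bound) j pj fj<bound with Fin.any? (λ e′ → P? e′ ×-dec (f e′ <? f j))
    ... | yes (e′ , pe′ , fe′<fj) = descend bound e′ pe′ (<-≤-trans fe′<fj (≤-pred fj<bound))
    ... | no  ∄smaller            = j , pj , λ e′ pe′ → ≮⇒≥ (λ fe′<fj → ∄smaller (e′ , pe′ , fe′<fj))

  lookup≡false⇒∉ : {B : Subset n} {e : Fin n} → lookup B e ≡ false → ¬ (e Subset.∈ B)
  lookup≡false⇒∉ e∉B e∈B = true≢false (trans (sym (V.[]=⇒lookup e∈B)) e∉B)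

  ∉⇒lookup≡false : {B : Subset n} {e : Fin n} → ¬ (e Subset.∈ B) → lookup B e ≡ false
  ∉⇒lookup≡false {B = B} {e} e∉B with lookup B e in eq
  ... | true  = contradiction (V.lookup⇒[]= e B eq) e∉B
  ... | false = refl

  foldr-⊓-≤ : ∀ x ys → foldr _⊓_ x ys ≤ x
  foldr-⊓-≤ x []       = ≤-refl
  foldr-⊓-≤ x (y ∷ ys) = ≤-trans (m⊓n≤n y _) (foldr-⊓-≤ x ys)

  foldr-⊓-≤-∈ : ∀ x {ys y} → y ∈ ys → foldr _⊓_ x ys ≤ y
  foldr-⊓-≤-∈ x (here refl)  = m⊓n≤m _ _
  foldr-⊓-≤-∈ x (there y∈ys) = ≤-trans (m⊓n≤n _ _) (foldr-⊓-≤-∈ x y∈ys)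

  foldr-⊓-sel : ∀ x ys → foldr _⊓_ x ys ≡ x ⊎ foldr _⊓_ x ys ∈ ys
  foldr-⊓-sel x []       = inj₁ refl
  foldr-⊓-sel x (y ∷ ys) with ⊓-sel y (foldr _⊓_ x ys) | foldr-⊓-sel x ys
  ... | inj₁ ⊓≡y | _          = inj₂ (here ⊓≡y)
  ... | inj₂ ⊓≡r | inj₁ r≡x   = inj₁ (trans ⊓≡r r≡x)
  ... | inj₂ ⊓≡r | inj₂ r∈ys  = inj₂ (there (subst (_∈ ys) (sym ⊓≡r) r∈ys))

  minList-≤ : ∀ {xs x} → x ∈ xs → minList xs ≤ x
  minList-≤ {y ∷ ys} (here refl)  = foldr-⊓-≤ y ys
  minList-≤ {y ∷ ys} (there x∈ys) = foldr-⊓-≤-∈ y x∈ys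

  minList-∈ : ∀ {xs x} → x ∈ xs → minList xs ∈ xs
  minList-∈ {y ∷ ys} _ with foldr-⊓-sel y ys
  ... | inj₁ min≡y   = here min≡y
  ... | inj₂ min∈ys  = there min∈ys

  -- Bases and generic weights

  module _ (M : Matroid n) where
    open Matroid M

    exchange-lookup : ∀ {B₁ B₂ x} → IsBase B₁ → IsBase B₂ → lookup B₁ x ≡ true → lookup B₂ x ≡ false →
                      ∃ λ y → lookup B₂ y ≡ true × lookup B₁ y ≡ false × IsBase (B₁ [ x ⇄ y ])
    exchange-lookup {B₁} {x = x} b₁ b₂ x∈B₁ x∉B₂
      with y , y∈B₂ , y∉B₁ , b ← exchange b₁ b₂ (V.lookup⇒[]= x B₁ x∈B₁) (lookup≡false⇒∉ x∉B₂)
      = y , V.[]=⇒lookup y∈B₂ , ∉⇒lookup≡false y∉B₁ , b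

    -- B₃ stays a base containing B₁ ∩ B₂ and y; each step trades an element of B₃ ∖ B₁ other than y
    -- for one of B₁, until B₃ ∖ B₁ = {y} and exchanging into B₁ from B₃ must bring in y.
    dualExchange-via : ∀ bound {B₁ B₂ y} B₃ → ∣ B₃ ∖ B₁ ∣ < bound → IsBase B₁ → IsBase B₂ → IsBase B₃ →
                       (∀ e → lookup B₁ e ≡ true → lookup B₂ e ≡ true → lookup B₃ e ≡ true) →
                       lookup B₃ y ≡ true → lookup B₁ y ≡ false →
                       ∃ λ x → lookup B₁ x ≡ true × lookup B₂ x ≡ false × IsBase (B₁ [ x ⇄ y ])
    dualExchange-via (suc bound) {B₁} {B₂} {y} B₃ size b₁ b₂ b₃ B₁∩B₂⊆B₃ y∈B₃ y∉B₁
      with Fin.any? (λ z → (lookup B₃ z Bool.≟ true) ×-dec (lookup B₁ z Bool.≟ false) ×-dec ¬? (z Fin.≟ y))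
    ... | yes (z , z∈B₃ , z∉B₁ , z≢y) =
      let w , w∈B₁ , w∉B₃ , b₃′ = exchange-lookup b₃ b₁ z∈B₃ z∉B₁
      in dualExchange-via bound (B₃ [ z ⇄ w ]) (<-≤-trans (∣⇄∖∣-< B₃ B₁ z∈B₃ z∉B₁ w∈B₁) (≤-pred size))
           b₁ b₂ b₃′ (B₁∩B₂⊆B₃[z⇄ w ]) (lookup-⇄-kept B₃ z w y∈B₃ z≢y) y∉B₁
      where
      B₁∩B₂⊆B₃[z⇄_] : ∀ w e → lookup B₁ e ≡ true → lookup B₂ e ≡ true → lookup (B₃ [ z ⇄ w ]) e ≡ true
      B₁∩B₂⊆B₃[z⇄ w ] e e∈B₁ e∈B₂ =
        lookup-⇄-kept B₃ z w (B₁∩B₂⊆B₃ e e∈B₁ e∈B₂) (λ { refl → true≢false (trans (sym e∈B₁) z∉B₁) })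
    ... | no B₃∖B₁⊆y with Fin.any? (λ x → (lookup B₁ x Bool.≟ true) ×-dec (lookup B₃ x Bool.≟ false))
    ...   | yes (x , x∈B₁ , x∉B₃) with y′ , y′∈B₃ , y′∉B₁ , b ← exchange-lookup b₁ b₃ x∈B₁ x∉B₃ with y′ Fin.≟ y
    ...     | yes refl = x , x∈B₁ , x∉B₂ , b
      where
      x∉B₂ : lookup B₂ x ≡ false
      x∉B₂ with lookup B₂ x in x∈B₂
      ... | true  = contradiction (trans (sym (B₁∩B₂⊆B₃ x x∈B₁ x∈B₂)) x∉B₃) true≢false
      ... | false = refl
    ...     | no y′≢y  = contradiction (y′ , y′∈B₃ , y′∉B₁ , y′≢y) B₃∖B₁⊆y
    dualExchange-via (suc bound) {B₁} {B₂} {y} B₃ size b₁ b₂ b₃ B₁∩B₂⊆B₃ y∈B₃ y∉B₁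
        | no _ | no B₁⊆B₃ =
      let w , w∈B₁ , w∉B₃ , _ = exchange-lookup b₃ b₁ y∈B₃ y∉B₁ in contradiction (w , w∈B₁ , w∉B₃) B₁⊆B₃

    dualExchange : ∀ {B₁ B₂ y} → IsBase B₁ → IsBase B₂ → lookup B₂ y ≡ true → lookup B₁ y ≡ false →
                   ∃ λ x → lookup B₁ x ≡ true × lookup B₂ x ≡ false × IsBase (B₁ [ x ⇄ y ])
    dualExchange {B₁} {B₂} b₁ b₂ = dualExchange-via (suc ∣ B₂ ∖ B₁ ∣) B₂ ≤-refl b₁ b₂ b₂ (λ _ _ e∈B₂ → e∈B₂)

    IsLocalMin : (Fin n → ℕ) → Subset n → Set
    IsLocalMin f B = ∀ x y → lookup B x ≡ true → lookup B y ≡ false → IsBase (B [ x ⇄ y ]) → f x < f y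

    isLocalMin? : (f : Fin n → ℕ) (B : Subset n) → Dec (IsLocalMin f B)
    isLocalMin? f B = Fin.all? λ x → Fin.all? λ y →
      (lookup B x Bool.≟ true) →-dec (lookup B y Bool.≟ false) →-dec isBase? (B [ x ⇄ y ]) →-dec (f x <? f y)

    module _ (f : Fin n → ℕ) {B : Subset n} (isBase-B : IsBase B) (localMin : IsLocalMin f B) where

      -- Induction on ∣ B′ ∖ B ∣, exchanging along the element of the symmetric difference of least weight.
      localMin⇒globalMin-bounded : ∀ bound {B′} → ∣ B′ ∖ B ∣ < bound → IsBase B′ → B′ ≢ B → weight f B < weight f B′
      localMin⇒globalMin-bounded (suc bound) {B′} size isBase-B′ B′≢B
        with e , e∈B△B′ , minimal ← minimiser (λ e → ¬? (lookup B e Bool.≟ lookup B′ e)) f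
               (Fin.¬∀⟶∃¬ n _ (λ e → lookup B e Bool.≟ lookup B′ e) (λ B≗B′ → B′≢B (sym (lookup-extensionality B≗B′))))
        with lookup B e in e∈B | lookup B′ e in e∈B′
      ... | true  | true  = contradiction refl e∈B△B′
      ... | false | false = contradiction refl e∈B△B′
      ... | false | true  =
        let x , x∈B , x∉B′ , b = dualExchange isBase-B isBase-B′ e∈B′ e∈B
        in contradiction (minimal x (λ eq → true≢false (trans (sym x∈B) (trans eq x∉B′)))) (<⇒≱ (localMin x e x∈B e∈B b))
      ... | true  | false with x′ , x′∈B′ , x′∉B , b ← dualExchange isBase-B′ isBase-B e∈B e∈B′
                          with B′ [ x′ ⇄ e ] ≟ˢ B
      ...   | yes B′[x′⇄e]≡B = balance-< (trans (cong (λ C → weight f C + f x′) (sym B′[x′⇄e]≡B)) (weight-⇄ f x′∈B′ e∈B′))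
                                 (localMin e x′ e∈B x′∉B (subst IsBase B′≡B[e⇄x′] isBase-B′))
        where
        B′≡B[e⇄x′] : B′ ≡ B [ e ⇄ x′ ]
        B′≡B[e⇄x′] = trans (sym (⇄-⇄ B′ x′∈B′ e∈B′)) (cong (λ C → C [ e ⇄ x′ ]) B′[x′⇄e]≡B)
      ...   | no  B′[x′⇄e]≢B = <-≤-trans
        (localMin⇒globalMin-bounded bound (<-≤-trans (∣⇄∖∣-< B′ B x′∈B′ x′∉B e∈B) (≤-pred size)) b B′[x′⇄e]≢B)
        (balance-≤ (weight-⇄ f x′∈B′ e∈B′) (minimal x′ (λ eq → true≢false (trans (sym x′∈B′) (trans (sym eq) x′∉B)))))

      localMin⇒globalMin : ∀ {B′} → IsBase B′ → B′ ≢ B → weight f B < weight f B′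
      localMin⇒globalMin {B′} = localMin⇒globalMin-bounded (suc ∣ B′ ∖ B ∣) ≤-refl

    localMin-unique : (f : Fin n → ℕ) {B B′ : Subset n} → IsBase B → IsLocalMin f B → IsBase B′ → IsLocalMin f B′ → B ≡ B′
    localMin-unique f {B} {B′} isBase-B localMin isBase-B′ localMin′ with B ≟ˢ B′
    ... | yes B≡B′ = B≡B′
    ... | no  B≢B′ = contradiction (localMin⇒globalMin f isBase-B localMin isBase-B′ (B≢B′ ∘ sym))
                                   (<-asym (localMin⇒globalMin f isBase-B′ localMin′ isBase-B B≢B′))

    ∑-bases : (g : Subset n → ℕ) → ∑ (bases M) g ≡ ∑[ B ∈ allSubsets n ] (χ (isBase? B) * g B)
    ∑-bases g = ∑-filter isBase? (allSubsets n) g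

    ∑-bases-χ : ∀ {p} {P : Pred (Subset n) p} (P? : Decidable P) →
                ∑[ B ∈ bases M ] χ (P? B) ≡ ∑[ B ∈ allSubsets n ] χ (isBase? B ×-dec P? B)
    ∑-bases-χ P? = trans (∑-bases _) (∑-cong (allSubsets n) (λ B → sym (χ-× (isBase? B) (P? B))))

    base∈bases : ∀ {B} → IsBase B → B ∈ bases M
    base∈bases {B} isBase-B = ∑-χ-pos⇒any (B ≟ˢ_) (bases M) (≤-reflexive (sym occursOnce-in-bases))
      where
      occursOnce-in-bases : ∑[ B′ ∈ bases M ] χ (B ≟ˢ B′) ≡ 1
      occursOnce-in-bases = trans (∑-bases-χ (B ≟ˢ_))
        (∑-χ-unique (allSubsets-enumerates n) (λ B′ → isBase? B′ ×-dec (B ≟ˢ B′)) (isBase-B , refl) (λ _ → sym ∘ proj₂))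

    module _ (f : Fin n → ℕ) where

      minWeight : ℕ
      minWeight = minList (map (weight f) (bases M))

      minWeight-≤ : ∀ {B} → IsBase B → minWeight ≤ weight f B
      minWeight-≤ isBase-B = minList-≤ (∈-map⁺ (weight f) (base∈bases isBase-B))

      minWeight-attained : ∃ λ B → IsBase B × weight f B ≡ minWeight
      minWeight-attained
        with B , B∈bases , min≡ ← ∈-map⁻ (weight f) (minList-∈ (∈-map⁺ (weight f) (base∈bases (proj₂ base-exists))))
        = B , proj₂ (∈-filter⁻ isBase? {xs = allSubsets n} B∈bases) , sym min≡

      IsMinimal : Subset n → Set
      IsMinimal B = IsBase B × weight f B ≡ minWeight

      isMinimal? : (B : Subset n) → Dec (IsMinimal B)
      isMinimal? B = isBase? B ×-dec (weight f B ≟ minWeight)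

      #minimal : length (filter (λ B → weight f B ≟ minWeight) (bases M)) ≡ ∑[ B ∈ allSubsets n ] χ (isMinimal? B)
      #minimal = trans (length-filter-∑ _ (bases M)) (∑-bases-χ (λ B → weight f B ≟ minWeight))

      generic⇒#minimal≡1 : T (isGeneric M f) → ∑[ B ∈ allSubsets n ] χ (isMinimal? B) ≡ 1
      generic⇒#minimal≡1 generic = trans (sym #minimal) (≡ᵇ⇒≡ _ 1 generic)

      #minimal≡1⇒generic : ∑[ B ∈ allSubsets n ] χ (isMinimal? B) ≡ 1 → T (isGeneric M f)
      #minimal≡1⇒generic one = ≡⇒≡ᵇ _ 1 (trans #minimal one)

      localMin⇒generic : ∀ {B} → IsBase B → IsLocalMin f B → T (isGeneric M f)
      localMin⇒generic {B} isBase-B localMin =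
        #minimal≡1⇒generic (∑-χ-unique (allSubsets-enumerates n) isMinimal? (isBase-B , B-minimal) unique)
        where
        lighter : ∀ {B′} → IsBase B′ → B′ ≢ B → weight f B < weight f B′
        lighter = localMin⇒globalMin f isBase-B localMin
        B-minimal : weight f B ≡ minWeight
        B-minimal with B₀ , isBase-B₀ , B₀-minimal ← minWeight-attained with B₀ ≟ˢ B
        ... | yes refl  = B₀-minimal
        ... | no  B₀≢B  = contradiction (subst (_≤ weight f B) (sym B₀-minimal) (minWeight-≤ isBase-B))
                                        (<⇒≱ (lighter isBase-B₀ B₀≢B))
        unique : ∀ B′ → IsMinimal B′ → B′ ≡ B
        unique B′ (isBase-B′ , B′-minimal) with B′ ≟ˢ B
        ... | yes B′≡B = B′≡B
        ... | no  B′≢B = contradiction (trans B-minimal (sym B′-minimal)) (<⇒≢ (lighter isBase-B′ B′≢B))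

      exchange-lighter : ∀ {B x y} → lookup B x ≡ true → lookup B y ≡ false →
                         weight f B < weight f (B [ x ⇄ y ]) → f x < f y
      exchange-lighter {B} {x} {y} x∈B y∉B =
        balance-< (trans (+-comm (f x) _) (trans (weight-⇄ f x∈B y∉B) (+-comm _ (f y))))

      exchange-not-heavier : ∀ {B x y} → lookup B x ≡ true → lookup B y ≡ false →
                             weight f B ≤ weight f (B [ x ⇄ y ]) → f x ≤ f y
      exchange-not-heavier {B} {x} {y} x∈B y∉B =
        balance-≤ (trans (+-comm (f x) _) (trans (weight-⇄ f x∈B y∉B) (+-comm _ (f y))))

      generic⇒localMin : T (isGeneric M f) → ∃ λ B → IsBase B × IsLocalMin f B
      generic⇒localMin generic with B , isBase-B , B-minimal ← minWeight-attained =
        B , isBase-B , λ x y x∈B y∉B isBase-B[x⇄y] → exchange-lighter x∈B y∉B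
          (≤∧≢⇒< (subst (_≤ _) (sym B-minimal) (minWeight-≤ isBase-B[x⇄y]))
                 (λ same → B≢B[x⇄y] x y y∉B (unique-minimal (isBase-B[x⇄y] , trans (sym same) B-minimal))))
        where
        unique-minimal : ∀ {B′} → IsMinimal B′ → B′ ≡ B
        unique-minimal minimal′ = ∑-χ≡1⇒unique (allSubsets-enumerates n) isMinimal? (generic⇒#minimal≡1 generic)
                                    minimal′ (isBase-B , B-minimal)
        B≢B[x⇄y] : ∀ x y → lookup B y ≡ false → B [ x ⇄ y ] ≢ B
        B≢B[x⇄y] x y y∉B eq = true≢false (trans (sym (lookup-⇄-new B x y)) (trans (cong (λ C → lookup C y) eq) y∉B))

      injective⇒localMin : Injective _≡_ _≡_ f → ∃ λ B → IsBase B × IsLocalMin f B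
      injective⇒localMin inj with B , isBase-B , B-minimal ← minWeight-attained =
        B , isBase-B , λ x y x∈B y∉B isBase-B[x⇄y] →
          ≤∧≢⇒< (exchange-not-heavier x∈B y∉B (subst (_≤ _) (sym B-minimal) (minWeight-≤ isBase-B[x⇄y])))
                (λ fx≡fy → true≢false (trans (sym x∈B) (trans (cong (lookup B) (inj fx≡fy)) y∉B)))

      χᵇ-isGeneric : χᵇ (isGeneric M f) ≡ ∑[ B ∈ bases M ] χ (isLocalMin? f B)
      χᵇ-isGeneric = sym (trans (∑-bases-χ (isLocalMin? f)) count)
        where
        count : ∑[ B ∈ allSubsets n ] χ (isBase? B ×-dec isLocalMin? f B) ≡ χᵇ (isGeneric M f)
        count with isGeneric M f in generic
        ... | true with B , isBase-B , localMin ← generic⇒localMin (subst T (sym generic) _) =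
          ∑-χ-unique (allSubsets-enumerates n) (λ B′ → isBase? B′ ×-dec isLocalMin? f B′) (isBase-B , localMin)
            (λ B′ (isBase-B′ , localMin′) → localMin-unique f isBase-B′ localMin′ isBase-B localMin)
        count | false = ∑-χ-none (λ B′ → isBase? B′ ×-dec isLocalMin? f B′) (allSubsets n)
          (λ B′ (isBase-B′ , localMin′) → subst T generic (localMin⇒generic isBase-B′ localMin′))

  -- Compositions and refinement

  infix 4 _≟ₗ_
  _≟ₗ_ : DecidableEquality (List ℕ)
  _≟ₗ_ = List.≡-dec _≟_

  IsComposition : ℕ → List ℕ → Set
  IsComposition m α = All (0 <_) α × sum α ≡ m

  isComposition? : ∀ m α → Dec (IsComposition m α)
  isComposition? m α = All.all? (0 <?_) α ×-dec (sum α ≟ m)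

  χ-<-suc : ∀ x n → χ (x <? n) + χ (x ≟ n) ≡ χ (x <? suc n)
  χ-<-suc x n with <-cmp x n
  ... | tri< x<n x≢n _ = trans (cong₂ _+_ (χ-yes (x <? n) x<n) (χ-no (x ≟ n) x≢n)) (sym (χ-yes (x <? suc n) (m<n⇒m<1+n x<n)))
  ... | tri≈ x≮n refl _ = trans (cong₂ _+_ (χ-no (x <? n) x≮n) (χ-yes (x ≟ n) refl)) (sym (χ-yes (x <? suc n) ≤-refl))
  ... | tri> _ x≢n n<x = trans (cong₂ _+_ (χ-no (x <? n) (<-asym n<x)) (χ-no (x ≟ n) x≢n))
                               (sym (χ-no (x <? suc n) (λ x<1+n → <⇒≱ n<x (≤-pred x<1+n))))

  upTo-occurrences : ∀ n x → ∑[ k ∈ upTo n ] χ (x ≟ k) ≡ χ (x <? n)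
  upTo-occurrences zero    x = refl
  upTo-occurrences (suc n) x = begin
    ∑[ k ∈ upTo (suc n) ] χ (x ≟ k)            ≡⟨ cong (λ ks → ∑[ k ∈ ks ] χ (x ≟ k)) (upTo-∷ʳ n) ⟨
    ∑[ k ∈ upTo n ∷ʳ n ] χ (x ≟ k)             ≡⟨ ∑-++ (upTo n) (n ∷ []) _ ⟩
    ∑[ k ∈ upTo n ] χ (x ≟ k) + (χ (x ≟ n) + 0) ≡⟨ cong₂ _+_ (upTo-occurrences n x) (+-identityʳ _) ⟩
    χ (x <? n) + χ (x ≟ n)                      ≡⟨ χ-<-suc x n ⟩
    χ (x <? suc n)                               ∎
    where open ≡-Reasoning

  positive-sum≢0 : ∀ {a} α → 0 < a → a + sum α ≢ 0
  positive-sum≢0 {a} α 0<a = >⇒≢ (<-≤-trans 0<a (m≤m+n a (sum α)))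

  composition-∷⁺ : ∀ {m x α} → x ≤ m → IsComposition (m ∸ x) α → IsComposition (suc m) (suc x ∷ α)
  composition-∷⁺ {x = x} x≤m (pos , sum≡) = z<s ∷ pos , cong suc (trans (cong (x +_) sum≡) (m+[n∸m]≡n x≤m))

  composition-∷⁻ : ∀ {m x α} → IsComposition (suc m) (suc x ∷ α) → x ≤ m × IsComposition (m ∸ x) α
  composition-∷⁻ {x = x} {α} (_ ∷ pos , sum≡) =
    subst (x ≤_) (suc-injective sum≡) (m≤m+n x (sum α)) , pos , trans (sym (m+n∸m≡n x (sum α))) (cong (_∸ x) (suc-injective sum≡))

  compsFuel-occurrences : ∀ fuel m → m ≤ fuel → ∀ α →
                          ∑[ β ∈ compsFuel fuel m ] χ (α ≟ₗ β) ≡ χ (isComposition? m α)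
  compsFuel-occurrences fuel zero _ [] = refl
  compsFuel-occurrences fuel zero _ (x ∷ α) =
    sym (χ-no (isComposition? 0 (x ∷ α)) λ { (0<x ∷ _ , sum≡0) → positive-sum≢0 α 0<x sum≡0 })
  compsFuel-occurrences (suc fuel) (suc m) (s≤s m≤fuel) α = begin
    ∑ (concatMap (λ k → map (suc k ∷_) (compsFuel fuel (m ∸ k))) (upTo (suc m))) (λ β → χ (α ≟ₗ β))
      ≡⟨ ∑-concatMap (λ k → map (suc k ∷_) (compsFuel fuel (m ∸ k))) (upTo (suc m)) (λ β → χ (α ≟ₗ β)) ⟩
    ∑[ k ∈ upTo (suc m) ] ∑ (map (suc k ∷_) (compsFuel fuel (m ∸ k))) (λ β → χ (α ≟ₗ β))
      ≡⟨ ∑-cong (upTo (suc m)) (λ k → ∑-map (suc k ∷_) (compsFuel fuel (m ∸ k)) _) ⟩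
    ∑[ k ∈ upTo (suc m) ] ∑[ γ ∈ compsFuel fuel (m ∸ k) ] χ (α ≟ₗ suc k ∷ γ)
      ≡⟨ byHead α ⟩
    χ (isComposition? (suc m) α) ∎
    where
    open ≡-Reasoning
    byHead : ∀ α → ∑[ k ∈ upTo (suc m) ] ∑[ γ ∈ compsFuel fuel (m ∸ k) ] χ (α ≟ₗ suc k ∷ γ) ≡
                   χ (isComposition? (suc m) α)
    byHead [] = ∑-zero (upTo (suc m)) (λ k → ∑-zero (compsFuel fuel (m ∸ k)) (λ γ → refl))
    byHead (zero ∷ α) = trans (∑-zero (upTo (suc m)) (λ k → ∑-zero (compsFuel fuel (m ∸ k)) (λ γ → refl)))
                              (sym (χ-no (isComposition? (suc m) (zero ∷ α)) λ { (() ∷ _ , _) }))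
    byHead (suc x ∷ α) = begin
      ∑[ k ∈ upTo (suc m) ] ∑[ γ ∈ compsFuel fuel (m ∸ k) ] χ (suc x ∷ α ≟ₗ suc k ∷ γ)
        ≡⟨ ∑-cong (upTo (suc m)) (λ k → trans (∑-cong (compsFuel fuel (m ∸ k)) (λ γ → χᵇ-∧ (does (x ≟ k)) _))
                                                (∑-*ˡ (compsFuel fuel (m ∸ k)) _ (χ (x ≟ k)))) ⟩
      ∑[ k ∈ upTo (suc m) ] (χ (x ≟ k) * ∑[ γ ∈ compsFuel fuel (m ∸ k) ] χ (α ≟ₗ γ))
        ≡⟨ ∑-δ-count _≟_ (upTo (suc m)) x _ ⟩
      ∑[ k ∈ upTo (suc m) ] χ (x ≟ k) * rest
        ≡⟨ cong (_* rest) (upTo-occurrences (suc m) x) ⟩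
      χ (x <? suc m) * rest
        ≡⟨ byBound (x <? suc m) ⟩
      χ (isComposition? (suc m) (suc x ∷ α)) ∎
      where
      rest = ∑[ γ ∈ compsFuel fuel (m ∸ x) ] χ (α ≟ₗ γ)
      byBound : (x<1+m? : Dec (x < suc m)) → χ x<1+m? * rest ≡ χ (isComposition? (suc m) (suc x ∷ α))
      byBound (no  x≮1+m) = sym (χ-no (isComposition? (suc m) (suc x ∷ α)) (x≮1+m ∘ s≤s ∘ proj₁ ∘ composition-∷⁻))
      byBound (yes (s≤s x≤m)) = trans (+-identityʳ rest)
        (trans (compsFuel-occurrences fuel (m ∸ x) (≤-trans (m∸n≤m m x) m≤fuel) α)
               (χ-cong (isComposition? (m ∸ x) α) (isComposition? (suc m) (suc x ∷ α))
                       (composition-∷⁺ x≤m) (proj₂ ∘ composition-∷⁻)))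

  comps-occurrences : ∀ m α → ∑[ β ∈ comps m ] χ (α ≟ₗ β) ≡ χ (isComposition? m α)
  comps-occurrences m = compsFuel-occurrences m m ≤-refl

  ∑-comps-δ : ∀ m α (g : List ℕ → ℕ) → ∑[ β ∈ comps m ] (χ (α ≟ₗ β) * g β) ≡ χ (isComposition? m α) * g α
  ∑-comps-δ m α g = trans (∑-δ-count _≟ₗ_ (comps m) α g) (cong (_* g α) (comps-occurrences m α))

  ∈comps⇒composition : ∀ {n α} → α ∈ comps n → IsComposition n α
  ∈comps⇒composition {n} {α} α∈comps = χ-pos (isComposition? n α) (subst (0 <_) (comps-occurrences n α) positive)
    where
    positive : 0 < ∑[ β ∈ comps n ] χ (α ≟ₗ β)
    positive = subst (_< ∑[ β ∈ comps n ] χ (α ≟ₗ β)) (∑-zero (comps n) (λ _ → refl))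
      (∑-mono-< {f = λ _ → 0} (λ _ → z≤n) α∈comps (≤-reflexive (sym (χ-yes (α ≟ₗ α) refl))))

  ≡ᵇ-refl : ∀ b → (b ≡ᵇ b) ≡ true
  ≡ᵇ-refl b = dec-true (b ≟ b) refl

  ≡ᵇ-false : ∀ {a b} → a ≢ b → (a ≡ᵇ b) ≡ false
  ≡ᵇ-false {a} {b} = dec-false (a ≟ b)

  <ᵇ-true : ∀ {a b} → a < b → (a <ᵇ b) ≡ true
  <ᵇ-true {a} {b} = dec-true (a <? b)

  <ᵇ-false : ∀ {a b} → ¬ a < b → (a <ᵇ b) ≡ false
  <ᵇ-false {a} {b} = dec-false (a <? b)

  refines-refl : ∀ α → refines α α ≡ true
  refines-refl []      = refl
  refines-refl (a ∷ α) rewrite ≡ᵇ-refl a = refines-refl α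

  refines⇒length-≤ : ∀ β α → refines β α ≡ true → length α ≤ length β
  refines⇒length-≤ []      []      _ = z≤n
  refines⇒length-≤ (b ∷ β) (a ∷ α) r with b ≡ᵇ a | b <ᵇ a
  ... | true  | _    = s≤s (refines⇒length-≤ β α r)
  ... | false | true = ≤-trans (refines⇒length-≤ β ((a ∸ b) ∷ α) r) (n≤1+n _)

  refines⇒≡ : ∀ β α → refines β α ≡ true → length α ≡ length β → α ≡ β
  refines⇒≡ []      []      _ _ = refl
  refines⇒≡ (b ∷ β) (a ∷ α) r same-length with b ≡ᵇ a in b≡ᵇa | b <ᵇ a
  ... | true  | _    = cong₂ _∷_ (sym (≡ᵇ⇒≡ b a (subst T (sym b≡ᵇa) _))) (refines⇒≡ β α r (suc-injective same-length))
  ... | false | true = contradiction (≤-trans (refines⇒length-≤ β ((a ∸ b) ∷ α) r) (≤-reflexive (suc-injective (sym same-length))))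
                                     1+n≰n

  IsPartialSum : ℕ → List ℕ → Set
  IsPartialSum k []      = ⊥
  IsPartialSum k (g ∷ γ) = k ≡ g ⊎ ∃ λ k′ → k ≡ g + k′ × IsPartialSum k′ γ

  partialSum-pos : ∀ {k γ} → All (0 <_) γ → IsPartialSum k γ → 0 < k
  partialSum-pos {γ = g ∷ γ} (0<g ∷ _) (inj₁ refl)           = 0<g
  partialSum-pos {γ = g ∷ γ} (0<g ∷ _) (inj₂ (k′ , refl , _)) = <-≤-trans 0<g (m≤m+n g k′)

  sum-split : ∀ {a b} α β → b < a → sum (b ∷ β) ≡ sum (a ∷ α) → sum β ≡ sum ((a ∸ b) ∷ α)
  sum-split {a} {b} α β b<a sums≡ = +-cancelˡ-≡ b _ _ (begin
    b + sum β             ≡⟨ sums≡ ⟩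
    a + sum α             ≡⟨ cong (_+ sum α) (m+[n∸m]≡n (<⇒≤ b<a)) ⟨
    b + (a ∸ b) + sum α   ≡⟨ +-assoc b (a ∸ b) (sum α) ⟩
    b + ((a ∸ b) + sum α) ∎)
    where open ≡-Reasoning

  refines⇒partialSums-⊇ : ∀ β α → All (0 <_) β → All (0 <_) α → sum β ≡ sum α → refines β α ≡ true →
                           ∀ k → IsPartialSum k α → IsPartialSum k β
  refines⇒partialSums-⊇ (b ∷ β) (a ∷ α) (_ ∷ pos-β) (_ ∷ pos-α) sums≡ r k k∈α with <-cmp b a
  ... | tri≈ _ refl _ rewrite ≡ᵇ-refl b = head k∈α
    where
    head : IsPartialSum k (b ∷ α) → IsPartialSum k (b ∷ β)
    head (inj₁ k≡b)               = inj₁ k≡b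
    head (inj₂ (k′ , k≡ , k′∈α)) =
      inj₂ (k′ , k≡ , refines⇒partialSums-⊇ β α pos-β pos-α (+-cancelˡ-≡ b _ _ sums≡) r k′ k′∈α)
  ... | tri< b<a _ _ rewrite ≡ᵇ-false (<⇒≢ b<a) | <ᵇ-true b<a = head k∈α
    where
    b+[a∸b]≡a = m+[n∸m]≡n (<⇒≤ b<a)
    rest = refines⇒partialSums-⊇ β ((a ∸ b) ∷ α) pos-β (m<n⇒0<n∸m b<a ∷ pos-α) (sum-split α β b<a sums≡) r
    head : IsPartialSum k (a ∷ α) → IsPartialSum k (b ∷ β)
    head (inj₁ refl) = inj₂ (a ∸ b , sym b+[a∸b]≡a , rest (a ∸ b) (inj₁ refl))
    head (inj₂ (k′ , refl , k′∈α)) = inj₂ ((a ∸ b) + k′ ,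
      trans (cong (_+ k′) (sym b+[a∸b]≡a)) (+-assoc b (a ∸ b) k′) , rest ((a ∸ b) + k′) (inj₂ (k′ , refl , k′∈α)))
  ... | tri> _ _ a<b rewrite ≡ᵇ-false (>⇒≢ a<b) | <ᵇ-false (<⇒≯ a<b) = contradiction r λ ()
  refines⇒partialSums-⊇ [] (a ∷ α) _ (0<a ∷ _) sums≡ = contradiction (sym sums≡) (positive-sum≢0 α 0<a)

  partialSums-⊇⇒refines : ∀ β α → All (0 <_) β → All (0 <_) α → sum β ≡ sum α →
                           (∀ k → IsPartialSum k α → IsPartialSum k β) → refines β α ≡ true
  partialSums-⊇⇒refines []      []      _ _ _ _ = refl
  partialSums-⊇⇒refines []      (a ∷ α) _ (0<a ∷ _) sums≡ _ = contradiction (sym sums≡) (positive-sum≢0 α 0<a)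
  partialSums-⊇⇒refines (b ∷ β) []      (0<b ∷ _) _ sums≡ _ = contradiction sums≡ (positive-sum≢0 β 0<b)
  partialSums-⊇⇒refines (b ∷ β) (a ∷ α) (_ ∷ pos-β) (_ ∷ pos-α) sums≡ α⊆β with <-cmp b a
  ... | tri≈ _ refl _ rewrite ≡ᵇ-refl b = partialSums-⊇⇒refines β α pos-β pos-α (+-cancelˡ-≡ b _ _ sums≡) tail⊆
    where
    tail⊆ : ∀ k → IsPartialSum k α → IsPartialSum k β
    tail⊆ k k∈α with α⊆β (b + k) (inj₂ (k , refl , k∈α))
    ... | inj₁ b+k≡b              = contradiction (+-cancelˡ-≡ b k 0 (trans b+k≡b (sym (+-identityʳ b))))
                                                  (>⇒≢ (partialSum-pos pos-α k∈α))
    ... | inj₂ (k′ , b+k≡ , k′∈β) = subst (λ j → IsPartialSum j β) (sym (+-cancelˡ-≡ b _ _ b+k≡)) k′∈β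
  ... | tri< b<a _ _ rewrite ≡ᵇ-false (<⇒≢ b<a) | <ᵇ-true b<a =
    partialSums-⊇⇒refines β ((a ∸ b) ∷ α) pos-β (m<n⇒0<n∸m b<a ∷ pos-α) (sum-split α β b<a sums≡) tail⊆
    where
    b+[a∸b]≡a = m+[n∸m]≡n (<⇒≤ b<a)
    tail⊆ : ∀ k → IsPartialSum k ((a ∸ b) ∷ α) → IsPartialSum k β
    tail⊆ k (inj₁ refl) with α⊆β a (inj₁ refl)
    ... | inj₁ a≡b                = contradiction (sym a≡b) (<⇒≢ b<a)
    ... | inj₂ (k′ , a≡ , k′∈β)   = subst (λ j → IsPartialSum j β) (+-cancelˡ-≡ b _ _ (trans (sym a≡) (sym b+[a∸b]≡a))) k′∈β
    tail⊆ k (inj₂ (k″ , refl , k″∈α)) with α⊆β (a + k″) (inj₂ (k″ , refl , k″∈α))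
    ... | inj₁ a+k″≡b             = contradiction (subst (a ≤_) a+k″≡b (m≤m+n a k″)) (<⇒≱ b<a)
    ... | inj₂ (k′ , a+k″≡ , k′∈β) = subst (λ j → IsPartialSum j β)
      (+-cancelˡ-≡ b _ _ (trans (sym a+k″≡) (trans (cong (_+ k″) (sym b+[a∸b]≡a)) (+-assoc b (a ∸ b) k″)))) k′∈β
  ... | tri> _ _ a<b with α⊆β a (inj₁ refl)
  ...   | inj₁ a≡b              = contradiction a≡b (<⇒≢ a<b)
  ...   | inj₂ (k′ , a≡b+k′ , _) = contradiction (subst (b ≤_) (sym a≡b+k′) (m≤m+n b k′)) (<⇒≱ a<b)

  prefixSum : List ℕ → ℕ → ℕ
  prefixSum xs j = sum (take j xs)

  prefixSum-length : ∀ xs → prefixSum xs (length xs) ≡ sum xs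
  prefixSum-length xs = cong sum (take-all (length xs) xs ≤-refl)

  positives : List ℕ → List ℕ
  positives = filter (0 <?_)

  sum-positives : ∀ xs → sum (positives xs) ≡ sum xs
  sum-positives []           = refl
  sum-positives (zero  ∷ xs) = sum-positives xs
  sum-positives (suc x ∷ xs) = cong (suc x +_) (sum-positives xs)

  partialSum-positives⇒ : ∀ xs k → IsPartialSum k (positives xs) → ∃ λ j → prefixSum xs j ≡ k
  partialSum-positives⇒ (zero ∷ xs) k k∈xs = let j , eq = partialSum-positives⇒ xs k k∈xs in suc j , eq
  partialSum-positives⇒ (suc x ∷ xs) k (inj₁ refl) = 1 , +-identityʳ (suc x)
  partialSum-positives⇒ (suc x ∷ xs) k (inj₂ (k′ , refl , k′∈xs)) =
    let j , eq = partialSum-positives⇒ xs k′ k′∈xs in suc j , cong (suc x +_) eq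

  partialSum-positives⇐ : ∀ xs {k} → 0 < k → ∀ j → prefixSum xs j ≡ k → IsPartialSum k (positives xs)
  partialSum-positives⇐ xs           0<k zero    refl = contradiction 0<k (<-irrefl refl)
  partialSum-positives⇐ []           0<k (suc j) refl = contradiction 0<k (<-irrefl refl)
  partialSum-positives⇐ (zero  ∷ xs) 0<k (suc j) eq = partialSum-positives⇐ xs 0<k j eq
  partialSum-positives⇐ (suc x ∷ xs) 0<k (suc j) eq with prefixSum xs j in rest
  ... | zero  = inj₁ (trans (sym eq) (+-identityʳ (suc x)))
  ... | suc t = inj₂ (suc t , sym eq , partialSum-positives⇐ xs z<s j rest)

  -- cutComposition c n is the composition of n obtained by cutting 0, …, n - 1 between i and i + 1 exactly
  -- when c i; runs c r m builds it when the current part has length suc r and m elements remain.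
  runs : (ℕ → Bool) → ℕ → ℕ → List ℕ
  runs c r zero    = suc r ∷ []
  runs c r (suc m) = if c 0 then suc r ∷ runs (c ∘ suc) 0 m else runs (c ∘ suc) (suc r) m

  cutComposition : (ℕ → Bool) → ℕ → List ℕ
  cutComposition c zero    = []
  cutComposition c (suc m) = runs c 0 m

  runs-positive : ∀ c r m → All (0 <_) (runs c r m)
  runs-positive c r zero    = z<s ∷ []
  runs-positive c r (suc m) with c 0
  ... | true  = z<s ∷ runs-positive (c ∘ suc) 0 m
  ... | false = runs-positive (c ∘ suc) (suc r) m

  runs-sum : ∀ c r m → sum (runs c r m) ≡ suc r + m
  runs-sum c r zero    = refl
  runs-sum c r (suc m) with c 0
  ... | true  = cong (suc r +_) (runs-sum (c ∘ suc) 0 m)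
  ... | false = trans (runs-sum (c ∘ suc) (suc r) m) (sym (+-suc (suc r) m))

  runs-length : ∀ c r m → length (runs c r m) ≤ suc m
  runs-length c r zero    = ≤-refl
  runs-length c r (suc m) with c 0
  ... | true  = s≤s (runs-length (c ∘ suc) 0 m)
  ... | false = m≤n⇒m≤1+n (runs-length (c ∘ suc) (suc r) m)

  RunBoundary : (ℕ → Bool) → ℕ → ℕ → ℕ → Set
  RunBoundary c r m k = k ≡ suc r + m ⊎ ∃ λ i → i < m × c i ≡ true × k ≡ suc r + i

  partialSum-runs⇒ : ∀ c r m k → IsPartialSum k (runs c r m) → RunBoundary c r m k
  partialSum-runs⇒ c r zero    k (inj₁ k≡) = inj₁ (trans k≡ (cong suc (sym (+-identityʳ r))))
  partialSum-runs⇒ c r (suc m) k k∈runs with c 0 in c0 | k∈runs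
  ... | true  | inj₁ k≡ = inj₂ (0 , z<s , c0 , trans k≡ (cong suc (sym (+-identityʳ r))))
  ... | true  | inj₂ (k′ , k≡ , k′∈runs) with partialSum-runs⇒ (c ∘ suc) 0 m k′ k′∈runs
  ...   | inj₁ k′≡                  = inj₁ (trans k≡ (cong (suc r +_) k′≡))
  ...   | inj₂ (i , i<m , cut , k′≡) = inj₂ (suc i , s≤s i<m , cut , trans k≡ (cong (suc r +_) k′≡))
  partialSum-runs⇒ c r (suc m) k _ | false | k∈runs with partialSum-runs⇒ (c ∘ suc) (suc r) m k k∈runs
  ...   | inj₁ k≡                  = inj₁ (trans k≡ (sym (+-suc (suc r) m)))
  ...   | inj₂ (i , i<m , cut , k≡) = inj₂ (suc i , s≤s i<m , cut , trans k≡ (sym (+-suc (suc r) i)))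

  partialSum-runs⇐ : ∀ c r m k → RunBoundary c r m k → IsPartialSum k (runs c r m)
  partialSum-runs⇐ c r zero    k (inj₁ k≡) = inj₁ (trans k≡ (cong suc (+-identityʳ r)))
  partialSum-runs⇐ c r (suc m) k boundary with c 0 in c0 | boundary
  ... | true  | inj₁ k≡ = inj₂ (suc m , k≡ , partialSum-runs⇐ (c ∘ suc) 0 m (suc m) (inj₁ refl))
  ... | true  | inj₂ (zero , _ , _ , k≡) = inj₁ (trans k≡ (cong suc (+-identityʳ r)))
  ... | true  | inj₂ (suc i , s≤s i<m , cut , k≡) =
    inj₂ (suc i , k≡ , partialSum-runs⇐ (c ∘ suc) 0 m (suc i) (inj₂ (i , i<m , cut , refl)))
  ... | false | inj₁ k≡ = partialSum-runs⇐ (c ∘ suc) (suc r) m k (inj₁ (trans k≡ (+-suc (suc r) m)))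
  ... | false | inj₂ (zero , _ , cut , _) = contradiction (trans (sym cut) c0) λ ()
  ... | false | inj₂ (suc i , s≤s i<m , cut , k≡) =
    partialSum-runs⇐ (c ∘ suc) (suc r) m k (inj₂ (i , i<m , cut , trans k≡ (+-suc (suc r) i)))

  runs-ones⇐ : ∀ c m → (∀ i → i < m → c i ≡ true) → runs c 0 m ≡ replicate (suc m) 1
  runs-ones⇐ c zero    _   = refl
  runs-ones⇐ c (suc m) all rewrite all 0 z<s = cong (1 ∷_) (runs-ones⇐ (c ∘ suc) m (λ i i<m → all (suc i) (s≤s i<m)))

  runs-ones⇒ : ∀ c r m → runs c r m ≡ replicate (suc m) 1 → ∀ i → i < m → c i ≡ true
  runs-ones⇒ c r (suc m) ones with c 0 in c0
  ... | true  = λ { zero _ → c0 ; (suc i) (s≤s i<m) → runs-ones⇒ (c ∘ suc) 0 m (List.∷-injectiveʳ ones) i i<m }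
  ... | false = contradiction (≤-trans (≤-reflexive (sym (trans (cong length ones) (length-replicate (suc (suc m))))))
                                       (runs-length (c ∘ suc) (suc r) m)) 1+n≰n

  cutComposition-isComposition : ∀ c n → IsComposition n (cutComposition c n)
  cutComposition-isComposition c zero    = [] , refl
  cutComposition-isComposition c (suc m) = runs-positive c 0 m , runs-sum c 0 m

  cutComposition-ones⇒ : ∀ c n → cutComposition c n ≡ replicate n 1 → ∀ i → suc i < n → c i ≡ true
  cutComposition-ones⇒ c (suc m) ones i (s≤s i<m) = runs-ones⇒ c 0 m ones i i<m

  cutComposition-ones⇐ : ∀ c n → (∀ i → suc i < n → c i ≡ true) → cutComposition c n ≡ replicate n 1
  cutComposition-ones⇐ c zero    _   = refl
  cutComposition-ones⇐ c (suc m) all = runs-ones⇐ c m (λ i i<m → all i (s≤s i<m))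

  CutsArePrefixSums : (ℕ → Bool) → ℕ → List ℕ → Set
  CutsArePrefixSums c n xs = ∀ i → suc i < n → c i ≡ true → ∃ λ j → prefixSum xs j ≡ suc i

  refines-cutComposition⇒ : ∀ c n xs → sum xs ≡ n → refines (positives xs) (cutComposition c n) ≡ true →
                             CutsArePrefixSums c n xs
  refines-cutComposition⇒ c (suc m) xs sum≡ r i (s≤s i<m) cut =
    partialSum-positives⇒ xs (suc i)
      (refines⇒partialSums-⊇ (positives xs) (runs c 0 m) (all-filter (0 <?_) xs) (runs-positive c 0 m)
        (trans (sum-positives xs) (trans sum≡ (sym (runs-sum c 0 m)))) r (suc i)
        (partialSum-runs⇐ c 0 m (suc i) (inj₂ (i , i<m , cut , refl))))

  refines-cutComposition⇐ : ∀ c n xs → sum xs ≡ n → CutsArePrefixSums c n xs →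
                             refines (positives xs) (cutComposition c n) ≡ true
  refines-cutComposition⇐ c zero xs sum≡ _ =
    partialSums-⊇⇒refines (positives xs) [] (all-filter (0 <?_) xs) [] (trans (sum-positives xs) sum≡) (λ _ ())
  refines-cutComposition⇐ c (suc m) xs sum≡ cuts =
    partialSums-⊇⇒refines (positives xs) (runs c 0 m) (all-filter (0 <?_) xs) (runs-positive c 0 m)
      (trans (sum-positives xs) (trans sum≡ (sym (runs-sum c 0 m)))) boundary⇒prefixSum
    where
    boundary⇒prefixSum : ∀ k → IsPartialSum k (runs c 0 m) → IsPartialSum k (positives xs)
    boundary⇒prefixSum k k∈runs with partialSum-runs⇒ c 0 m k k∈runs
    ... | inj₁ refl = partialSum-positives⇐ xs z<s (length xs) (trans (prefixSum-length xs) sum≡)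
    ... | inj₂ (i , i<m , cut , refl) = let j , eq = cuts i (s≤s i<m) cut in partialSum-positives⇐ xs z<s j eq

  listEq-sound : ∀ xs ys → T (listEq xs ys) → xs ≡ ys
  listEq-sound []       []       _ = refl
  listEq-sound (x ∷ xs) (y ∷ ys) t =
    let x≡ᵇy , rest = Equivalence.to Bool.T-∧ t in cong₂ _∷_ (≡ᵇ⇒≡ x y x≡ᵇy) (listEq-sound xs ys rest)

  listEq-refl : ∀ xs → T (listEq xs xs)
  listEq-refl []       = _
  listEq-refl (x ∷ xs) = Equivalence.from Bool.T-∧ (≡⇒≡ᵇ x x refl , listEq-refl xs)

  if-1-0 : ∀ b → (if b then 1 else 0) ≡ χᵇ b
  if-1-0 true  = refl
  if-1-0 false = refl

  coeffM≡χ : ∀ β {N} (a : Vec ℕ N) → coeffM β a ≡ χ (compress a ≟ₗ β)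
  coeffM≡χ β a = trans (if-1-0 (listEq (compress a) β))
    (χ-cong (T? (listEq (compress a) β)) (compress a ≟ₗ β) (listEq-sound _ β) (λ { refl → listEq-refl β }))

  coeffL-formula : ∀ n α {N} (a : Vec ℕ N) →
                   coeffL n α a ≡ χ (isComposition? n (compress a)) * χᵇ (refines (compress a) α)
  coeffL-formula n α a = trans (∑-cong (comps n) pointwise) (∑-comps-δ n (compress a) (λ β → χᵇ (refines β α)))
    where
    pointwise : ∀ β → (if refines β α then coeffM β a else 0) ≡ χ (compress a ≟ₗ β) * χᵇ (refines β α)
    pointwise β with refines β α
    ... | true  = trans (coeffM≡χ β a) (sym (*-identityʳ _))
    ... | false = sym (*-zeroʳ (χ (compress a ≟ₗ β)))

  compress-fromList : ∀ {α} → All (0 <_) α → compress (fromList α) ≡ α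
  compress-fromList {α} pos = trans (cong positives (V.toList∘fromList α)) (filter-all (0 <?_) pos)

  coeffL-fromList : ∀ n γ {β} → IsComposition n β → coeffL n γ (fromList β) ≡ χᵇ (refines β γ)
  coeffL-fromList n γ {β} β⊨n = begin
    coeffL n γ (fromList β)
      ≡⟨ coeffL-formula n γ (fromList β) ⟩
    χ (isComposition? n (compress (fromList β))) * χᵇ (refines (compress (fromList β)) γ)
      ≡⟨ cong (λ α → χ (isComposition? n α) * χᵇ (refines α γ)) (compress-fromList (proj₁ β⊨n)) ⟩
    χ (isComposition? n β) * χᵇ (refines β γ)
      ≡⟨ trans (cong (_* χᵇ (refines β γ)) (χ-yes (isComposition? n β) β⊨n)) (+-identityʳ _) ⟩
    χᵇ (refines β γ) ∎
    where open ≡-Reasoning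

  ones-isComposition : ∀ m → IsComposition m (replicate m 1)
  ones-isComposition zero    = [] , refl
  ones-isComposition (suc m) = let pos , sum≡ = ones-isComposition m in z<s ∷ pos , cong suc sum≡

  ones-refines : ∀ m {α} → IsComposition m α → refines (replicate m 1) α ≡ true
  ones-refines zero    {[]}              _                   = refl
  ones-refines zero    {a ∷ α}           (0<a ∷ _ , sum≡0)   = contradiction sum≡0 (positive-sum≢0 α 0<a)
  ones-refines (suc m) {suc zero ∷ α}    (_ ∷ pos , sum≡)    = ones-refines m (pos , suc-injective sum≡)
  ones-refines (suc m) {suc (suc a) ∷ α} (_ ∷ pos , sum≡)    = ones-refines m (z<s ∷ pos , suc-injective sum≡)

  coeffL-ones : ∀ n {α} → IsComposition n α → coeffL n α (V.replicate n 1) ≡ 1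
  coeffL-ones n {α} α⊨n = begin
    coeffL n α (V.replicate n 1)
      ≡⟨ coeffL-formula n α (V.replicate n 1) ⟩
    χ (isComposition? n (compress (V.replicate n 1))) * χᵇ (refines (compress (V.replicate n 1)) α)
      ≡⟨ cong (λ β → χ (isComposition? n β) * χᵇ (refines β α)) compress-ones ⟩
    χ (isComposition? n (replicate n 1)) * χᵇ (refines (replicate n 1) α)
      ≡⟨ cong₂ _*_ (χ-yes (isComposition? n (replicate n 1)) (ones-isComposition n)) (cong χᵇ (ones-refines n α⊨n)) ⟩
    1 ∎
    where
    open ≡-Reasoning
    compress-ones : compress (V.replicate n 1) ≡ replicate n 1
    compress-ones = trans (cong positives (V.toList-replicate n 1)) (filter-all (0 <?_) (proj₁ (ones-isComposition n)))

  module _ {p : Fin n → Fin n} (inj : Injective _≡_ _≡_ p) where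

    consecutive⇒related : ∀ {r} (R : Fin n → Fin n → Set r) → (∀ {a b c} → R a b → R b c → R a c) →
      ∀ {s} (Allowed : ℕ → Set s) → (∀ u u′ → toℕ (p u′) ≡ suc (toℕ (p u)) → Allowed (toℕ (p u)) → R u u′) →
      ∀ e e′ → toℕ (p e) < toℕ (p e′) → (∀ k → toℕ (p e) ≤ k → k < toℕ (p e′) → Allowed k) → R e e′
    consecutive⇒related R trans-R Allowed step e e′ pe<pe′ allowed = go (toℕ (p e′)) e′ refl pe<pe′ allowed
      where
      go : ∀ m e′ → toℕ (p e′) ≡ m → toℕ (p e) < m → (∀ k → toℕ (p e) ≤ k → k < m → Allowed k) → R e e′
      go (suc m) e′ pe′≡ (s≤s pe≤m) allowed with toℕ (p e) ≟ m
      ... | yes pe≡m = step e e′ (trans pe′≡ (cong suc (sym pe≡m))) (allowed (toℕ (p e)) ≤-refl (s≤s (≤-reflexive pe≡m)))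
      ... | no  pe≢m with u , pu≡ ← injective⇒surjective inj (fromℕ< (<-trans (n<1+n m) (subst (_< n) pe′≡ (Fin.toℕ<n (p e′)))))
        = trans-R (go m u pu≡m (≤∧≢⇒< pe≤m pe≢m) (λ k pe≤k k<m → allowed k pe≤k (m<n⇒m<1+n k<m)))
                  (step u e′ (trans pe′≡ (cong suc (sym pu≡m))) (subst Allowed (sym pu≡m) (allowed m pe≤m (n<1+n m))))
        where
        pu≡m : toℕ (p u) ≡ m
        pu≡m = trans (cong toℕ pu≡) (Fin.toℕ-fromℕ< _)

    downClosed⇔below : ∀ {d} {D : Fin n → Set d} (D? : Decidable D) → (∀ e e′ → D e′ → toℕ (p e) < toℕ (p e′) → D e) →
                       ∀ {m} → ∑[ e ∈ allFin n ] χ (D? e) ≡ m → ∀ e → (D e → toℕ (p e) < m) × (toℕ (p e) < m → D e)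
    downClosed⇔below {D = D} D? downClosed {m} size e = to , from
      where
      to : D e → toℕ (p e) < m
      to De = subst (suc (toℕ (p e)) ≤_) size
        (subst (_≤ ∑[ e ∈ allFin n ] χ (D? e)) (injective-count-< inj (suc (toℕ (p e))) (Fin.toℕ<n (p e)))
          (∑-mono-≤ (allFin n) λ e′ → χ-mono (toℕ (p e′) <? suc (toℕ (p e))) (D? e′) (below⇒D e′)))
        where
        below⇒D : ∀ e′ → toℕ (p e′) < suc (toℕ (p e)) → D e′
        below⇒D e′ (s≤s pe′≤pe) with m≤n⇒m<n∨m≡n pe′≤pe
        ... | inj₁ pe′<pe = downClosed e′ e De pe′<pe
        ... | inj₂ pe′≡pe = subst D (inj (Fin.toℕ-injective (sym pe′≡pe))) De
      from : toℕ (p e) < m → D e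
      from pe<m with D? e
      ... | yes De = De
      ... | no ¬De = contradiction pe<m (≤⇒≯ (subst (_≤ toℕ (p e)) size
        (subst (∑[ e ∈ allFin n ] χ (D? e) ≤_) (injective-count-< inj (toℕ (p e)) (<⇒≤ (Fin.toℕ<n (p e))))
          (∑-mono-≤ (allFin n) λ e′ → χ-mono (D? e′) (toℕ (p e′) <? toℕ (p e)) (D⇒below e′)))))
        where
        D⇒below : ∀ e′ → D e′ → toℕ (p e′) < toℕ (p e)
        D⇒below e′ De′ with <-cmp (toℕ (p e′)) (toℕ (p e))
        ... | tri< pe′<pe _ _ = pe′<pe
        ... | tri≈ _ pe′≡pe _ = contradiction (subst D (inj (Fin.toℕ-injective pe′≡pe)) De′) ¬De
        ... | tri> _ _ pe<pe′ = contradiction (downClosed e e′ De′ pe<pe′) ¬De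

  IsRanking : (Fin n → ℕ) → (Fin n → Fin n) → Set
  IsRanking κ p = ∀ e e′ → toℕ (p e) < toℕ (p e′) → κ e < κ e′

  isRanking? : (κ : Fin n → ℕ) (p : Fin n → Fin n) → Dec (IsRanking κ p)
  isRanking? κ p = Fin.all? λ e → Fin.all? λ e′ → (toℕ (p e) <? toℕ (p e′)) →-dec (κ e <? κ e′)

  ranking-reflects : {κ : Fin n → ℕ} {p : Fin n → Fin n} → Injective _≡_ _≡_ p → IsRanking κ p →
                     ∀ {e e′} → κ e < κ e′ → toℕ (p e) < toℕ (p e′)
  ranking-reflects {p = p} inj ranks {e} {e′} κe<κe′ with <-cmp (toℕ (p e)) (toℕ (p e′))
  ... | tri< pe<pe′ _ _ = pe<pe′
  ... | tri≈ _ pe≡pe′ _ = contradiction κe<κe′ (<-irrefl (cong _ (inj (Fin.toℕ-injective pe≡pe′))))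
  ... | tri> _ _ pe′<pe = contradiction (ranks e′ e pe′<pe) (<-asym κe<κe′)

  module _ (κ : Fin n → ℕ) (κ-inj : Injective _≡_ _≡_ κ) where

    rank : Fin n → ℕ
    rank e = ∑[ e′ ∈ allFin n ] χ (κ e′ <? κ e)

    rank<n : ∀ e → rank e < n
    rank<n e = <-≤-trans
      (∑-mono-< (λ e′ → χ-≤1 (κ e′ <? κ e)) (∈-allFin e) (≤-reflexive (cong suc (χ-no (κ e <? κ e) (<-irrefl refl)))))
      (≤-reflexive (trans (∑-allFin-const n 1) (*-identityʳ n)))

    rank-mono : ∀ {e e′} → κ e < κ e′ → rank e < rank e′
    rank-mono {e} {e′} κe<κe′ = ∑-mono-< (λ e″ → χ-mono (κ e″ <? κ e) (κ e″ <? κ e′) (λ κe″<κe → <-trans κe″<κe κe<κe′))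
      (∈-allFin e) (subst₂ _<_ (sym (χ-no (κ e <? κ e) (<-irrefl refl))) (sym (χ-yes (κ e <? κ e′) κe<κe′)) z<s)

    ranking : Vec (Fin n) n
    ranking = V.tabulate (λ e → fromℕ< (rank<n e))

    toℕ-ranking : ∀ e → toℕ (lookup ranking e) ≡ rank e
    toℕ-ranking e = trans (cong toℕ (V.lookup∘tabulate _ e)) (Fin.toℕ-fromℕ< _)

    ranking-injective : Injective _≡_ _≡_ (lookup ranking)
    ranking-injective {e} {e′} same with <-cmp (κ e) (κ e′)
    ... | tri≈ _ κe≡κe′ _ = κ-inj κe≡κe′
    ... | tri< κe<κe′ _ _ = contradiction (trans (sym (toℕ-ranking e)) (trans (cong toℕ same) (toℕ-ranking e′)))
                                          (<⇒≢ (rank-mono κe<κe′))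
    ... | tri> _ _ κe′<κe = contradiction (trans (sym (toℕ-ranking e′)) (trans (cong toℕ (sym same)) (toℕ-ranking e)))
                                          (<⇒≢ (rank-mono κe′<κe))

    ranking-isRanking : IsRanking κ (lookup ranking)
    ranking-isRanking e e′ re<re′ with <-cmp (κ e) (κ e′)
    ... | tri< κe<κe′ _ _ = κe<κe′
    ... | tri≈ _ κe≡κe′ _ = contradiction re<re′ (<-irrefl (cong (toℕ ∘ lookup ranking) (κ-inj κe≡κe′)))
    ... | tri> _ _ κe′<κe = contradiction re<re′ (<-asym (subst₂ _<_ (sym (toℕ-ranking e′)) (sym (toℕ-ranking e)) (rank-mono κe′<κe)))

    ranking-unique : ∀ p → Injective _≡_ _≡_ (lookup p) → IsRanking κ (lookup p) → p ≡ ranking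
    ranking-unique p inj ranks = lookup-extensionality λ e → Fin.toℕ-injective (trans (position≡rank e) (sym (toℕ-ranking e)))
      where
      position≡rank : ∀ e → toℕ (lookup p e) ≡ rank e
      position≡rank e = trans (sym (injective-count-< inj (toℕ (lookup p e)) (<⇒≤ (Fin.toℕ<n _))))
        (∑-cong (allFin n) λ e′ → χ-cong (toℕ (lookup p e′) <? toℕ (lookup p e)) (κ e′ <? κ e) (ranks e′ e) (ranking-reflects inj ranks))

    ∃!ranking : ∑[ p ∈ allFuns n n ] χ (injective? (lookup p) ×-dec isRanking? κ (lookup p)) ≡ 1
    ∃!ranking = ∑-χ-unique (allFuns-enumerates n n) (λ p → injective? (lookup p) ×-dec isRanking? κ (lookup p))
      (ranking-injective , ranking-isRanking) (λ p (inj , ranks) → ranking-unique p inj ranks)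

  -- P-partitions

  lex-< : ∀ K {a b a′ b′} → b < K → a < a′ ⊎ (a ≡ a′ × b < b′) → a * K + b < a′ * K + b′
  lex-< K {a} {b} {a′} {b′} b<K (inj₁ a<a′) = begin-strict
    a * K + b     <⟨ +-monoʳ-< (a * K) b<K ⟩
    a * K + K     ≡⟨ +-comm (a * K) K ⟩
    suc a * K     ≤⟨ *-monoˡ-≤ K a<a′ ⟩
    a′ * K        ≤⟨ m≤m+n (a′ * K) b′ ⟩
    a′ * K + b′   ∎
    where open ≤-Reasoning
  lex-< K {a} _ (inj₂ (refl , b<b′)) = +-monoʳ-< (a * K) b<b′

  lex-<⁻ : ∀ K {a b a′ b′} → b′ < K → a * K + b < a′ * K + b′ → a < a′ ⊎ (a ≡ a′ × b < b′)
  lex-<⁻ K {a} {b} {a′} {b′} b′<K lt with <-cmp a a′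
  ... | tri< a<a′ _ _ = inj₁ a<a′
  ... | tri≈ _ refl _ = inj₂ (refl , +-cancelˡ-< (a * K) b b′ lt)
  ... | tri> _ _ a′<a = contradiction lt (<-asym (lex-< K b′<K (inj₁ a′<a)))

  sum-toList : (a : Vec ℕ N) → sum (toList a) ≡ ∑[ i ∈ allFin N ] lookup a i
  sum-toList V.[]                = refl
  sum-toList {suc N} (x V.∷ a)   = trans (cong (x +_) (sum-toList a)) (sym (∑-allFin-suc {N} (lookup (x V.∷ a))))

  ∑-prefix : (a : Vec ℕ N) (j : ℕ) → ∑[ i ∈ allFin N ] (χ (toℕ i <? j) * lookup a i) ≡ prefixSum (toList a) j
  ∑-prefix V.[]      zero    = refl
  ∑-prefix V.[]      (suc j) = refl
  ∑-prefix {suc N} (x V.∷ a) zero    =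
    trans (∑-allFin-suc {N} (λ i → χ (toℕ i <? 0) * lookup (x V.∷ a) i)) (∑-zero (allFin N) (λ _ → refl))
  ∑-prefix {suc N} (x V.∷ a) (suc j) =
    trans (∑-allFin-suc {N} (λ i → χ (toℕ i <? suc j) * lookup (x V.∷ a) i)) (cong₂ _+_ (+-identityʳ x) (∑-prefix a j))

  prefixSum-≤-sum : ∀ xs j → prefixSum xs j ≤ sum xs
  prefixSum-≤-sum xs       zero    = z≤n
  prefixSum-≤-sum []       (suc j) = z≤n
  prefixSum-≤-sum (x ∷ xs) (suc j) = +-monoʳ-≤ x (prefixSum-≤-sum xs j)

  prefixSum-suc : (a : Vec ℕ N) (i : Fin N) → prefixSum (toList a) (suc (toℕ i)) ≡ prefixSum (toList a) (toℕ i) + lookup a i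
  prefixSum-suc (x V.∷ a) zero    = +-identityʳ x
  prefixSum-suc (x V.∷ a) (suc i) = trans (cong (x +_) (prefixSum-suc a i)) (sym (+-assoc x _ _))

  prefixSum-all : (a : Vec ℕ N) → prefixSum (toList a) N ≡ sum (toList a)
  prefixSum-all V.[]      = refl
  prefixSum-all (x V.∷ a) = cong (x +_) (prefixSum-all a)

  block : Vec ℕ N → ℕ → ℕ
  block V.[]      k = 0
  block (x V.∷ a) k with k <? x
  ... | yes _ = 0
  ... | no  _ = suc (block a (k ∸ x))

  block-< : ∀ x (a : Vec ℕ N) k → k < x → block (x V.∷ a) k ≡ 0
  block-< x a k k<x with k <? x
  ... | yes _   = refl
  ... | no  k≮x = contradiction k<x k≮x

  block-≥ : ∀ x (a : Vec ℕ N) k → ¬ k < x → block (x V.∷ a) k ≡ suc (block a (k ∸ x))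
  block-≥ x a k k≮x with k <? x
  ... | yes k<x = contradiction k<x k≮x
  ... | no  _   = refl

  block<⇔<prefixSum : (a : Vec ℕ N) (k : ℕ) → k < sum (toList a) → ∀ j →
                      (block a k < j → k < prefixSum (toList a) j) × (k < prefixSum (toList a) j → block a k < j)
  block<⇔<prefixSum (x V.∷ a) k k<sum zero    = (λ ()) , (λ ())
  block<⇔<prefixSum (x V.∷ a) k k<sum (suc j) = byHead (k <? x)
    where
    byHead : Dec (k < x) → (block (x V.∷ a) k < suc j → k < x + prefixSum (toList a) j) ×
                           (k < x + prefixSum (toList a) j → block (x V.∷ a) k < suc j)
    byHead (yes k<x) rewrite block-< x a k k<x = (λ _ → <-≤-trans k<x (m≤m+n x _)) , (λ _ → s≤s z≤n)
    byHead (no  k≮x) rewrite block-≥ x a k k≮x = to , from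
      where
      x+[k∸x]≡k = m+[n∸m]≡n (≮⇒≥ k≮x)
      rest = block<⇔<prefixSum a (k ∸ x) (+-cancelˡ-< x _ _ (subst (_< x + sum (toList a)) (sym x+[k∸x]≡k) k<sum)) j
      to : suc (block a (k ∸ x)) < suc j → k < x + prefixSum (toList a) j
      to (s≤s lt) = subst (_< x + prefixSum (toList a) j) x+[k∸x]≡k (+-monoʳ-< x (proj₁ rest lt))
      from : k < x + prefixSum (toList a) j → suc (block a (k ∸ x)) < suc j
      from lt = s≤s (proj₂ rest (+-cancelˡ-< x _ _ (subst (_< x + prefixSum (toList a) j) (sym x+[k∸x]≡k) lt)))

  block<N : (a : Vec ℕ N) (k : ℕ) → k < sum (toList a) → block a k < N
  block<N {N} a k k<sum = proj₂ (block<⇔<prefixSum a k k<sum N) (subst (k <_) (sym (prefixSum-all a)) k<sum)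

  -- Sorting a map h that increases strictly along Rel by
  -- (value, ω), where the labelling ω decreases along Rel, gives a permutation whose descents can only occur
  -- between the value blocks of h: the maps with exponent a are counted by the coefficients of x^a in the
  -- L of the descent compositions.
  module PPartitions {n} (Rel : Fin n → Fin n → Set) (Rel? : ∀ x y → Dec (Rel x y))
                     (ω : Fin n → ℕ) (ω-injective : Injective _≡_ _≡_ ω) (K : ℕ) (ω<K : ∀ e → ω e < K)
                     (Rel⇒ω> : ∀ {x y} → Rel x y → ω y < ω x) where

    -- Encodes the lexicographic order on (value under h, label).
    key : ∀ {N} → Vec (Fin N) n → Fin n → ℕ
    key h e = toℕ (lookup h e) * K + ω e

    key-<⁻ : ∀ {N} (h : Vec (Fin N) n) {e e′} → key h e < key h e′ →
             toℕ (lookup h e) < toℕ (lookup h e′) ⊎ (toℕ (lookup h e) ≡ toℕ (lookup h e′) × ω e < ω e′)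
    key-<⁻ h {e′ = e′} = lex-<⁻ K (ω<K e′)

    key-< : ∀ {N} (h : Vec (Fin N) n) {e e′} →
            toℕ (lookup h e) < toℕ (lookup h e′) ⊎ (toℕ (lookup h e) ≡ toℕ (lookup h e′) × ω e < ω e′) → key h e < key h e′
    key-< h {e} = lex-< K (ω<K e)

    key-injective : ∀ {N} (h : Vec (Fin N) n) → Injective _≡_ _≡_ (key h)
    key-injective h {e} {e′} same with <-cmp (toℕ (lookup h e)) (toℕ (lookup h e′))
    ... | tri< he<he′ _ _ = contradiction same (<⇒≢ (key-< h (inj₁ he<he′)))
    ... | tri> _ _ he′<he = contradiction (sym same) (<⇒≢ (key-< h (inj₁ he′<he)))
    ... | tri≈ _ he≡he′ _ = ω-injective (+-cancelˡ-≡ (toℕ (lookup h e) * K) _ _ (trans same (cong (λ m → m * K + ω e′) (sym he≡he′))))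

    key-<⇒≤ : ∀ {N} (h : Vec (Fin N) n) {e e′} → key h e < key h e′ → toℕ (lookup h e) ≤ toℕ (lookup h e′)
    key-<⇒≤ h lt with key-<⁻ h lt
    ... | inj₁ he<he′       = <⇒≤ he<he′
    ... | inj₂ (he≡he′ , _) = ≤-reflexive he≡he′

    Increasing : (Fin n → ℕ) → Set
    Increasing f = ∀ x y → Rel x y → f x < f y

    increasing? : (f : Fin n → ℕ) → Dec (Increasing f)
    increasing? f = Fin.all? λ x → Fin.all? λ y → Rel? x y →-dec (f x <? f y)

    module _ {N} (h : Vec (Fin N) n) (p : Vec (Fin n) n) (ranks : IsRanking (key h) (lookup p)) where

      increasing-ranking⁺ : Injective _≡_ _≡_ (lookup p) → Increasing (toℕ ∘ lookup h) → Increasing (toℕ ∘ lookup p)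
      increasing-ranking⁺ inj increasing x y r = ranking-reflects inj ranks (key-< h (inj₁ (increasing x y r)))

      increasing-ranking⁻ : Increasing (toℕ ∘ lookup p) → Increasing (toℕ ∘ lookup h)
      increasing-ranking⁻ increasing x y r with key-<⁻ h (ranks x y (increasing x y r))
      ... | inj₁ hx<hy         = hx<hy
      ... | inj₂ (_ , ωx<ωy)   = contradiction ωx<ωy (<-asym (Rel⇒ω> r))

    Descent : Vec (Fin n) n → ℕ → Set
    Descent p i = ∃ λ e → ∃ λ e′ → toℕ (lookup p e) ≡ i × toℕ (lookup p e′) ≡ suc i × ω e′ < ω e

    descent? : ∀ p i → Dec (Descent p i)
    descent? p i = Fin.any? λ e → Fin.any? λ e′ → (toℕ (lookup p e) ≟ i) ×-dec (toℕ (lookup p e′) ≟ suc i) ×-dec (ω e′ <? ω e)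

    descents : Vec (Fin n) n → ℕ → Bool
    descents p i = does (descent? p i)

    descentComposition : Vec (Fin n) n → List ℕ
    descentComposition p = cutComposition (descents p) n

    module _ {N} (a : Vec ℕ N) (p : Vec (Fin n) n) where

      Compatible : Vec (Fin N) n → Set
      Compatible h = HasExponent h a × IsRanking (key h) (lookup p)

      compatible? : (h : Vec (Fin N) n) → Dec (Compatible h)
      compatible? h = hasExponent? h a ×-dec isRanking? (key h) (lookup p)

    module _ {N} (a : Vec ℕ N) (p : Vec (Fin n) n) (p-injective : Injective _≡_ _≡_ (lookup p)) where

      private
        prefix : ℕ → ℕ
        prefix = prefixSum (toList a)

        position : Fin n → ℕ
        position e = toℕ (lookup p e)

      #below≡prefix : ∀ h → HasExponent h a → ∀ j → ∑[ e ∈ allFin n ] χ (toℕ (lookup h e) <? j) ≡ prefix j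
      #below≡prefix h exponent j = begin
        ∑[ e ∈ allFin n ] χ (toℕ (lookup h e) <? j)
          ≡⟨ ∑-cong (allFin n) (λ e → ∑-δ allFin-enumerates (lookup h e) (λ i → χ (toℕ i <? j))) ⟨
        ∑[ e ∈ allFin n ] ∑[ i ∈ allFin N ] (χ (lookup h e Fin.≟ i) * χ (toℕ i <? j))
          ≡⟨ ∑-comm (allFin n) (allFin N) _ ⟩
        ∑[ i ∈ allFin N ] ∑[ e ∈ allFin n ] (χ (lookup h e Fin.≟ i) * χ (toℕ i <? j))
          ≡⟨ ∑-cong (allFin N) fibre ⟩
        ∑[ i ∈ allFin N ] (χ (toℕ i <? j) * lookup a i)
          ≡⟨ ∑-prefix a j ⟩
        prefix j ∎
        where
        open ≡-Reasoning
        fibre : ∀ i → ∑[ e ∈ allFin n ] (χ (lookup h e Fin.≟ i) * χ (toℕ i <? j)) ≡ χ (toℕ i <? j) * lookup a i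
        fibre i = trans (∑-*ʳ (allFin n) _ _) (trans (cong (_* χ (toℕ i <? j)) (trans (sym (fiber-∑ h i)) (exponent i)))
                                                     (*-comm (lookup a i) _))

      blocks : ∀ h → Compatible a p h → ∀ j e →
               (toℕ (lookup h e) < j → position e < prefix j) × (position e < prefix j → toℕ (lookup h e) < j)
      blocks h (exponent , ranks) j = downClosed⇔below p-injective (λ e → toℕ (lookup h e) <? j)
        (λ e e′ he′<j pe<pe′ → ≤-<-trans (key-<⇒≤ h (ranks e e′ pe<pe′)) he′<j) (#below≡prefix h exponent j)

      compatible-unique : ∀ h h′ → Compatible a p h → Compatible a p h′ → h ≡ h′
      compatible-unique h h′ c c′ =
        lookup-extensionality λ e → Fin.toℕ-injective (≤-antisym (≤-values h h′ c c′ e) (≤-values h′ h c′ c e))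
        where
        ≤-values : ∀ h h′ → Compatible a p h → Compatible a p h′ → ∀ e → toℕ (lookup h e) ≤ toℕ (lookup h′ e)
        ≤-values h h′ c c′ e =
          ≤-pred (proj₂ (blocks h c (suc (toℕ (lookup h′ e))) e) (proj₁ (blocks h′ c′ (suc (toℕ (lookup h′ e))) e) ≤-refl))

      compatible⇒cuts : ∀ h → Compatible a p h → sum (toList a) ≡ n × CutsArePrefixSums (descents p) n (toList a)
      compatible⇒cuts h c@(exponent , ranks) = sum≡n , cuts
        where
        sum≡n : sum (toList a) ≡ n
        sum≡n = trans (sum-toList a) (trans (∑-cong (allFin N) (λ i → trans (sym (exponent i)) (fiber-∑ h i))) (∑-fibres (lookup h)))
        cuts : CutsArePrefixSums (descents p) n (toList a)
        cuts i _ descent with e , e′ , pe≡i , pe′≡1+i , ωe′<ωe ← does≡true⇒ (descent? p i) descent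
          with key-<⁻ h (ranks e e′ (subst₂ _<_ (sym pe≡i) (sym pe′≡1+i) (n<1+n i)))
        ... | inj₂ (_ , ωe<ωe′) = contradiction ωe<ωe′ (<-asym ωe′<ωe)
        ... | inj₁ he<he′ =
          toℕ (lookup h e′) , ≤-antisym prefix≤ (subst (_< prefix (toℕ (lookup h e′))) pe≡i (proj₁ (blocks h c _ e) he<he′))
          where
          prefix≤ : prefix (toℕ (lookup h e′)) ≤ suc i
          prefix≤ = subst (prefix (toℕ (lookup h e′)) ≤_) pe′≡1+i (≮⇒≥ (λ lt → <-irrefl refl (proj₂ (blocks h c _ e′) lt)))

      module _ (sum≡n : sum (toList a) ≡ n) (cuts : CutsArePrefixSums (descents p) n (toList a)) where

        position<sum : ∀ e → position e < sum (toList a)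
        position<sum e = subst (position e <_) (sym sum≡n) (Fin.toℕ<n (lookup p e))

        -- The element in position k goes to the block of a containing k.
        blockVector : Vec (Fin N) n
        blockVector = V.tabulate (λ e → fromℕ< (block<N a (position e) (position<sum e)))

        private
          h₀ = blockVector

        toℕ-blockVector : ∀ e → toℕ (lookup h₀ e) ≡ block a (position e)
        toℕ-blockVector e = trans (cong toℕ (V.lookup∘tabulate _ e)) (Fin.toℕ-fromℕ< _)

        blockVector-blocks : ∀ j e → (toℕ (lookup h₀ e) < j → position e < prefix j) × (position e < prefix j → toℕ (lookup h₀ e) < j)
        blockVector-blocks j e = (λ lt → proj₁ blocks-e (subst (_< j) (toℕ-blockVector e) lt))
                               , (λ lt → subst (_< j) (sym (toℕ-blockVector e)) (proj₂ blocks-e lt))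
          where blocks-e = block<⇔<prefixSum a (position e) (position<sum e) j

        #below-blockVector : ∀ j → ∑[ e ∈ allFin n ] χ (toℕ (lookup h₀ e) <? j) ≡ prefix j
        #below-blockVector j = trans
          (∑-cong (allFin n) λ e → χ-cong (toℕ (lookup h₀ e) <? j) (position e <? prefix j)
                                           (proj₁ (blockVector-blocks j e)) (proj₂ (blockVector-blocks j e)))
          (injective-count-< p-injective (prefix j) (subst (prefix j ≤_) sum≡n (prefixSum-≤-sum (toList a) j)))

        blockVector-exponent : HasExponent h₀ a
        blockVector-exponent i = +-cancelʳ-≡ (prefix (toℕ i)) _ _ (begin
          fiber h₀ i + prefix (toℕ i)
            ≡⟨ cong₂ _+_ (fiber-∑ h₀ i) (sym (#below-blockVector (toℕ i))) ⟩
          ∑[ e ∈ allFin n ] χ (lookup h₀ e Fin.≟ i) + ∑[ e ∈ allFin n ] χ (toℕ (lookup h₀ e) <? toℕ i)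
            ≡⟨ ∑-+ (allFin n) _ _ ⟨
          ∑[ e ∈ allFin n ] (χ (lookup h₀ e Fin.≟ i) + χ (toℕ (lookup h₀ e) <? toℕ i))
            ≡⟨ ∑-cong (allFin n) (λ e → χ-≟-<-suc (lookup h₀ e) i) ⟩
          ∑[ e ∈ allFin n ] χ (toℕ (lookup h₀ e) <? suc (toℕ i))
            ≡⟨ #below-blockVector (suc (toℕ i)) ⟩
          prefix (suc (toℕ i))
            ≡⟨ prefixSum-suc a i ⟩
          prefix (toℕ i) + lookup a i
            ≡⟨ +-comm (prefix (toℕ i)) (lookup a i) ⟩
          lookup a i + prefix (toℕ i) ∎)
          where
          open ≡-Reasoning
          χ-≟-<-suc : ∀ (x i : Fin N) → χ (x Fin.≟ i) + χ (toℕ x <? toℕ i) ≡ χ (toℕ x <? suc (toℕ i))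
          χ-≟-<-suc x i = trans (+-comm (χ (x Fin.≟ i)) _) (trans (cong (χ (toℕ x <? toℕ i) +_)
            (χ-cong (x Fin.≟ i) (toℕ x ≟ toℕ i) (cong toℕ) Fin.toℕ-injective)) (χ-<-suc (toℕ x) (toℕ i)))

        blockVector-monotone : ∀ {e e′} → position e < position e′ → toℕ (lookup h₀ e) ≤ toℕ (lookup h₀ e′)
        blockVector-monotone {e} {e′} pe<pe′ = ≮⇒≥ λ he′<he →
          <⇒≱ (<-trans pe<pe′ (proj₁ (blockVector-blocks _ e′) ≤-refl))
              (≮⇒≥ λ pe<prefix → <⇒≱ he′<he (≤-pred (proj₂ (blockVector-blocks _ e) pe<prefix)))

        NoCutAfter : ℕ → Set
        NoCutAfter k = ∀ j → prefix j ≢ suc k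

        sameBlock⇒noCut : ∀ {e e′} → lookup h₀ e ≡ lookup h₀ e′ → ∀ k → position e ≤ k → k < position e′ → NoCutAfter k
        sameBlock⇒noCut {e} {e′} same k pe≤k k<pe′ j prefix≡ = <-irrefl (cong toℕ same)
          (<-≤-trans (proj₂ (blockVector-blocks j e) (subst (position e <_) (sym prefix≡) (s≤s pe≤k)))
                     (≮⇒≥ λ he′<j → <⇒≱ (proj₁ (blockVector-blocks j e′) he′<j) (subst (_≤ position e′) (sym prefix≡) k<pe′)))

        noCut⇒ascent : ∀ u u′ → position u′ ≡ suc (position u) → NoCutAfter (position u) → ω u < ω u′
        noCut⇒ascent u u′ pu′≡ noCut with <-cmp (ω u) (ω u′)
        ... | tri< ωu<ωu′ _ _ = ωu<ωu′
        ... | tri≈ _ ωu≡ωu′ _ = contradiction (sym (trans (cong position (ω-injective ωu≡ωu′)) pu′≡)) (1+n≢n)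
        ... | tri> _ _ ωu′<ωu =
          let j , prefix≡ = cuts (position u) (subst (_< n) pu′≡ (Fin.toℕ<n (lookup p u′)))
                                 (dec-true (descent? p (position u)) (u , u′ , refl , pu′≡ , ωu′<ωu))
          in contradiction prefix≡ (noCut j)

        blockVector-ranks : IsRanking (key h₀) (lookup p)
        blockVector-ranks e e′ pe<pe′ with m≤n⇒m<n∨m≡n (blockVector-monotone pe<pe′)
        ... | inj₁ he<he′ = key-< h₀ (inj₁ he<he′)
        ... | inj₂ he≡he′ = key-< h₀ (inj₂ (he≡he′ ,
          consecutive⇒related p-injective (λ u u′ → ω u < ω u′) <-trans NoCutAfter noCut⇒ascent e e′ pe<pe′
            (sameBlock⇒noCut (Fin.toℕ-injective he≡he′))))

      #compatible : ∑[ h ∈ allFuns N n ] χ (compatible? a p h) ≡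
                    χ (isComposition? n (compress a)) * χᵇ (refines (compress a) (descentComposition p))
      #compatible with sum (toList a) ≟ n
      ... | no sum≢n = trans (∑-χ-none (compatible? a p) (allFuns N n) (λ h c → sum≢n (proj₁ (compatible⇒cuts h c))))
        (sym (cong (_* χᵇ (refines (compress a) (descentComposition p)))
                   (χ-no (isComposition? n (compress a)) (λ (_ , sum≡n) → sum≢n (trans (sym (sum-positives (toList a))) sum≡n)))))
      ... | yes sum≡n with refines (compress a) (descentComposition p) in refines≡
      ...   | true = trans
        (∑-χ-unique (allFuns-enumerates N n) (compatible? a p) {blockVector sum≡n cuts}
                    (blockVector-exponent sum≡n cuts , blockVector-ranks sum≡n cuts)
          (λ h c → compatible-unique h _ c (blockVector-exponent sum≡n cuts , blockVector-ranks sum≡n cuts)))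
        (sym (cong (_* 1) (χ-yes (isComposition? n (compress a)) (all-filter (0 <?_) (toList a) , trans (sum-positives (toList a)) sum≡n))))
        where cuts = refines-cutComposition⇒ (descents p) n (toList a) sum≡n refines≡
      ...   | false = trans
        (∑-χ-none (compatible? a p) (allFuns N n)
          (λ h c → contradiction (trans (sym (refines-cutComposition⇐ (descents p) n (toList a) sum≡n (proj₂ (compatible⇒cuts h c))))
                                        refines≡) λ ()))
        (sym (*-zeroʳ (χ (isComposition? n (compress a)))))

    χ-transfer : ∀ {i i′ e j r} {I : Set i} {I′ : Set i′} {E : Set e} {J : Set j} {R : Set r}
                 (I? : Dec I) (I′? : Dec I′) (E? : Dec E) (J? : Dec J) (R? : Dec R) → (J → R → I → I′) → (J → R → I′ → I) →
                 χ I? * χ E? * χ (J? ×-dec R?) ≡ χ (J? ×-dec I′?) * χ (E? ×-dec R?)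
    χ-transfer I? I′? E? (no _) R? _ _ = *-zeroʳ (χ I? * χ E?)
    χ-transfer I? I′? (yes _) (yes _) (no _) _ _ = trans (*-zeroʳ (χ I? * 1)) (sym (*-zeroʳ (χ I′?)))
    χ-transfer I? I′? (no _)  (yes _) (no _) _ _ = trans (*-zeroʳ (χ I? * 0)) (sym (*-zeroʳ (χ I′?)))
    χ-transfer (yes _) (yes _) (yes _) (yes _) (yes _) _ _ = refl
    χ-transfer (yes _) (yes _) (no _)  (yes _) (yes _) _ _ = refl
    χ-transfer (no _)  (no _)  _       (yes _) (yes _) _ _ = refl
    χ-transfer (yes i) (no ¬i′) _ (yes j) (yes r) to _ = contradiction (to j r i) ¬i′
    χ-transfer (no ¬i) (yes i′) _ (yes j) (yes r) _ from = contradiction (from j r i′) ¬i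

    increasingPermutation? : (p : Vec (Fin n) n) → Dec (Injective _≡_ _≡_ (lookup p) × Increasing (toℕ ∘ lookup p))
    increasingPermutation? p = injective? (lookup p) ×-dec increasing? (toℕ ∘ lookup p)

    ∑-increasing-exponent : ∀ {N} (a : Vec ℕ N) →
      ∑[ h ∈ allFuns N n ] (χ (increasing? (toℕ ∘ lookup h)) * χ (hasExponent? h a)) ≡
      ∑[ p ∈ allFuns n n ] (χ (increasingPermutation? p) * coeffL n (descentComposition p) a)
    ∑-increasing-exponent {N} a = begin
      ∑[ h ∈ hs ] (χ (increasing? (toℕ ∘ lookup h)) * χ (hasExponent? h a))
        ≡⟨ ∑-cong hs (λ h → trans (sym (*-identityʳ _))
             (cong (χ (increasing? (toℕ ∘ lookup h)) * χ (hasExponent? h a) *_) (sym (∃!ranking (key h) (key-injective h))))) ⟩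
      ∑[ h ∈ hs ] (χ (increasing? (toℕ ∘ lookup h)) * χ (hasExponent? h a) * ∑[ p ∈ ps ] χ (rankedBy? h p))
        ≡⟨ ∑-cong hs (λ h → ∑-*ˡ ps (λ p → χ (rankedBy? h p)) (χ (increasing? (toℕ ∘ lookup h)) * χ (hasExponent? h a))) ⟨
      ∑[ h ∈ hs ] ∑[ p ∈ ps ] (χ (increasing? (toℕ ∘ lookup h)) * χ (hasExponent? h a) * χ (rankedBy? h p))
        ≡⟨ ∑-cong hs (λ h → ∑-cong ps (λ p →
             χ-transfer (increasing? (toℕ ∘ lookup h)) (increasing? (toℕ ∘ lookup p)) (hasExponent? h a)
                        (injective? (lookup p)) (isRanking? (key h) (lookup p))
                        (λ inj ranks → increasing-ranking⁺ h p ranks inj) (λ _ ranks → increasing-ranking⁻ h p ranks))) ⟩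
      ∑[ h ∈ hs ] ∑[ p ∈ ps ] (χ (increasingPermutation? p) * χ (compatible? a p h))
        ≡⟨ ∑-comm hs ps _ ⟩
      ∑[ p ∈ ps ] ∑[ h ∈ hs ] (χ (increasingPermutation? p) * χ (compatible? a p h))
        ≡⟨ ∑-cong ps (λ p → ∑-*ˡ hs (λ h → χ (compatible? a p h)) (χ (increasingPermutation? p))) ⟩
      ∑[ p ∈ ps ] (χ (increasingPermutation? p) * ∑[ h ∈ hs ] χ (compatible? a p h))
        ≡⟨ ∑-cong ps (λ p → byInjectivity p (injective? (lookup p))) ⟩
      ∑[ p ∈ ps ] (χ (increasingPermutation? p) * coeffL n (descentComposition p) a) ∎
      where
      open ≡-Reasoning
      hs = allFuns N n
      ps = allFuns n n
      rankedBy? : (h : Vec (Fin N) n) (p : Vec (Fin n) n) → Dec (Injective _≡_ _≡_ (lookup p) × IsRanking (key h) (lookup p))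
      rankedBy? h p = injective? (lookup p) ×-dec isRanking? (key h) (lookup p)
      byInjectivity : ∀ p (inj? : Dec (Injective _≡_ _≡_ (lookup p))) →
                      χ (inj? ×-dec increasing? (toℕ ∘ lookup p)) * ∑[ h ∈ hs ] χ (compatible? a p h) ≡
                      χ (inj? ×-dec increasing? (toℕ ∘ lookup p)) * coeffL n (descentComposition p) a
      byInjectivity p (yes inj) = cong (χ (increasing? (toℕ ∘ lookup p)) *_)
        (trans (#compatible a p inj) (sym (coeffL-formula n (descentComposition p) a)))
      byInjectivity p (no _) = refl

    private
      reverseLabel : Fin n → ℕ
      reverseLabel e = K ∸ ω e

      reverseLabel-injective : Injective _≡_ _≡_ reverseLabel
      reverseLabel-injective {e} {e′} same = ω-injective (begin
        ω e             ≡⟨ m∸[m∸n]≡n (<⇒≤ (ω<K e)) ⟨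
        K ∸ (K ∸ ω e)   ≡⟨ cong (K ∸_) same ⟩
        K ∸ (K ∸ ω e′)  ≡⟨ m∸[m∸n]≡n (<⇒≤ (ω<K e′)) ⟩
        ω e′            ∎)
        where open ≡-Reasoning

      reverseLabel-< : ∀ {e e′} → ω e′ < ω e → reverseLabel e < reverseLabel e′
      reverseLabel-< {e} ωe′<ωe = ∸-monoʳ-< ωe′<ωe (<⇒≤ (ω<K e))

      reverseLabel-<⁻ : ∀ {e e′} → reverseLabel e < reverseLabel e′ → ω e′ < ω e
      reverseLabel-<⁻ lt = ≰⇒> (λ ωe≤ωe′ → <⇒≱ lt (∸-monoʳ-≤ K ωe≤ωe′))

    module _ (p : Vec (Fin n) n) (p-injective : Injective _≡_ _≡_ (lookup p)) where

      allDescents⇒ranking : descentComposition p ≡ replicate n 1 → IsRanking reverseLabel (lookup p)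
      allDescents⇒ranking ones e e′ pe<pe′ = reverseLabel-<
        (consecutive⇒related p-injective (λ u u′ → ω u′ < ω u) (λ ω<₁ ω<₂ → <-trans ω<₂ ω<₁) (λ _ → ⊤) descentStep
                             e e′ pe<pe′ _)
        where
        descentStep : ∀ u u′ → toℕ (lookup p u′) ≡ suc (toℕ (lookup p u)) → ⊤ → ω u′ < ω u
        descentStep u u′ pu′≡ _
          with e₁ , e₂ , pe₁≡ , pe₂≡ , ω<
             ← does≡true⇒ (descent? p _) (cutComposition-ones⇒ (descents p) n ones (toℕ (lookup p u))
                                            (subst (_< n) pu′≡ (Fin.toℕ<n (lookup p u′))))
          rewrite p-injective (Fin.toℕ-injective pe₁≡) | p-injective {e₂} {u′} (Fin.toℕ-injective (trans pe₂≡ (sym pu′≡))) = ω<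

      ranking⇒increasing : IsRanking reverseLabel (lookup p) → Increasing (toℕ ∘ lookup p)
      ranking⇒increasing ranks x y r = ranking-reflects p-injective ranks (reverseLabel-< (Rel⇒ω> r))

      ranking⇒allDescents : IsRanking reverseLabel (lookup p) → descentComposition p ≡ replicate n 1
      ranking⇒allDescents ranks = cutComposition-ones⇐ (descents p) n λ i 1+i<n → dec-true (descent? p i) (descentAt i 1+i<n)
        where
        descentAt : ∀ i → suc i < n → Descent p i
        descentAt i 1+i<n
          with u , pu≡ ← injective⇒surjective p-injective (fromℕ< (<-trans (n<1+n i) 1+i<n))
             | u′ , pu′≡ ← injective⇒surjective p-injective (fromℕ< 1+i<n)
          = u , u′ , position-u , position-u′ , reverseLabel-<⁻ (ranks u u′ (subst₂ _<_ (sym position-u) (sym position-u′) (n<1+n i)))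
          where
          position-u = trans (cong toℕ pu≡) (Fin.toℕ-fromℕ< _)
          position-u′ = trans (cong toℕ pu′≡) (Fin.toℕ-fromℕ< _)

    #allDescents : ∑[ p ∈ allFuns n n ] (χ (increasingPermutation? p) * χ (descentComposition p ≟ₗ replicate n 1)) ≡ 1
    #allDescents = trans (∑-cong (allFuns n n) allDescents≡ranking) (∃!ranking reverseLabel reverseLabel-injective)
      where
      allDescents≡ranking : ∀ p → χ (increasingPermutation? p) * χ (descentComposition p ≟ₗ replicate n 1) ≡
                                  χ (injective? (lookup p) ×-dec isRanking? reverseLabel (lookup p))
      allDescents≡ranking p = trans (sym (χ-× (increasingPermutation? p) (descentComposition p ≟ₗ replicate n 1)))
        (χ-cong (increasingPermutation? p ×-dec (descentComposition p ≟ₗ replicate n 1))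
                (injective? (lookup p) ×-dec isRanking? reverseLabel (lookup p)) (λ ((inj , _) , ones) → inj , allDescents⇒ranking p inj ones)
                    (λ (inj , ranks) → (inj , ranking⇒increasing p inj ranks) , ranking⇒allDescents p inj ranks))

  -- Uniqueness of the expansion in the L_α

  ∑ℤ : List A → (A → ℤ) → ℤ
  ∑ℤ xs f = foldr ℤ._+_ (ℤ.+ 0) (map f xs)

  ∑ℤ-cong-∈ : (xs : List A) {f g : A → ℤ} → (∀ x → x ∈ xs → f x ≡ g x) → ∑ℤ xs f ≡ ∑ℤ xs g
  ∑ℤ-cong-∈ []       eq = refl
  ∑ℤ-cong-∈ (x ∷ xs) eq = cong₂ ℤ._+_ (eq x (here refl)) (∑ℤ-cong-∈ xs (λ y y∈xs → eq y (there y∈xs)))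

  ∑ℤ-+ : (xs : List A) (f g : A → ℤ) → ∑ℤ xs (λ x → f x ℤ.+ g x) ≡ ∑ℤ xs f ℤ.+ ∑ℤ xs g
  ∑ℤ-+ []       f g = refl
  ∑ℤ-+ (x ∷ xs) f g = trans (cong (λ s → (f x ℤ.+ g x) ℤ.+ s) (∑ℤ-+ xs f g)) (ℤ-interchange (f x) (g x) (∑ℤ xs f) (∑ℤ xs g))

  ∑ℤ-*ʳ : (xs : List A) (f : A → ℤ) (c : ℤ) → ∑ℤ xs (λ x → f x ℤ.* c) ≡ ∑ℤ xs f ℤ.* c
  ∑ℤ-*ʳ []       f c = sym (ℤ.*-zeroˡ c)
  ∑ℤ-*ʳ (x ∷ xs) f c = trans (cong (λ s → f x ℤ.* c ℤ.+ s) (∑ℤ-*ʳ xs f c)) (sym (ℤ.*-distribʳ-+ c (f x) (∑ℤ xs f)))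

  ∑ℤ-pos : (xs : List A) (f : A → ℕ) → ∑ℤ xs (λ x → ℤ.+ f x) ≡ ℤ.+ ∑ xs f
  ∑ℤ-pos []       f = refl
  ∑ℤ-pos (x ∷ xs) f = trans (cong (λ s → ℤ.+ f x ℤ.+ s) (∑ℤ-pos xs f)) (sym (ℤ.pos-+ (f x) (∑ xs f)))

  ∑ℤ-foldr : (xs : List A) (c : A → ℤ) → ∑ℤ xs c ≡ foldr (λ x s → c x ℤ.+ s) (ℤ.+ 0) xs
  ∑ℤ-foldr []       c = refl
  ∑ℤ-foldr (x ∷ xs) c = cong (λ s → c x ℤ.+ s) (∑ℤ-foldr xs c)

  module _ (n : ℕ) where

    private
      strictRefinement : (List ℕ → ℤ) → List ℕ → List ℕ → ℤ
      strictRefinement d β γ with β ≟ₗ γ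
      ... | yes _ = ℤ.+ 0
      ... | no  _ = d γ ℤ.* ℤ.+ χᵇ (refines β γ)

    expansionCoeff-fromList : ∀ (c : List ℕ → ℤ) {β} → IsComposition n β →
      expansionCoeff n c (fromList β) ≡ c β ℤ.+ ∑ℤ (comps n) (strictRefinement c β)
    expansionCoeff-fromList c {β} β⊨n = begin
      expansionCoeff n c (fromList β)
        ≡⟨ ∑ℤ-cong-∈ (comps n) (λ γ _ → cong (λ k → c γ ℤ.* ℤ.+ k) (coeffL-fromList n γ β⊨n)) ⟩
      ∑ℤ (comps n) (λ γ → c γ ℤ.* ℤ.+ χᵇ (refines β γ))
        ≡⟨ ∑ℤ-cong-∈ (comps n) (λ γ _ → diagonal γ) ⟩
      ∑ℤ (comps n) (λ γ → ℤ.+ χ (β ≟ₗ γ) ℤ.* c β ℤ.+ strictRefinement c β γ)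
        ≡⟨ ∑ℤ-+ (comps n) _ _ ⟩
      ∑ℤ (comps n) (λ γ → ℤ.+ χ (β ≟ₗ γ) ℤ.* c β) ℤ.+ ∑ℤ (comps n) (strictRefinement c β)
        ≡⟨ cong (λ s → s ℤ.+ ∑ℤ (comps n) (strictRefinement c β))
                (trans (∑ℤ-*ʳ (comps n) _ (c β)) (cong (ℤ._* c β) (∑ℤ-pos (comps n) _))) ⟩
      ℤ.+ ∑[ γ ∈ comps n ] χ (β ≟ₗ γ) ℤ.* c β ℤ.+ ∑ℤ (comps n) (strictRefinement c β)
        ≡⟨ cong (λ k → ℤ.+ k ℤ.* c β ℤ.+ ∑ℤ (comps n) (strictRefinement c β))
                (trans (comps-occurrences n β) (χ-yes (isComposition? n β) β⊨n)) ⟩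
      ℤ.+ 1 ℤ.* c β ℤ.+ ∑ℤ (comps n) (strictRefinement c β)
        ≡⟨ cong (λ s → s ℤ.+ ∑ℤ (comps n) (strictRefinement c β)) (ℤ.*-identityˡ (c β)) ⟩
      c β ℤ.+ ∑ℤ (comps n) (strictRefinement c β) ∎
      where
      open ≡-Reasoning
      diagonal : ∀ γ → c γ ℤ.* ℤ.+ χᵇ (refines β γ) ≡ ℤ.+ χ (β ≟ₗ γ) ℤ.* c β ℤ.+ strictRefinement c β γ
      diagonal γ with β ≟ₗ γ
      ... | yes refl rewrite refines-refl β = trans (ℤ.*-identityʳ (c β)) (sym (trans (ℤ.+-identityʳ _) (ℤ.*-identityˡ (c β))))
      ... | no  _    = sym (ℤ.+-identityˡ _)

    module _ (c c′ : List ℕ → ℤ) (same : ∀ N (a : Vec ℕ N) → expansionCoeff n c a ≡ expansionCoeff n c′ a) where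

      expansion-unique-bounded : ∀ bound β → length β < bound → IsComposition n β → c β ≡ c′ β
      expansion-unique-bounded (suc bound) β length<bound β⊨n =
        ∙-cancelʳ (∑ℤ (comps n) (strictRefinement c′ β)) (c β) (c′ β) (begin
          c β ℤ.+ ∑ℤ (comps n) (strictRefinement c′ β)  ≡⟨ cong (λ s → c β ℤ.+ s) (∑ℤ-cong-∈ (comps n) coarser) ⟨
          c β ℤ.+ ∑ℤ (comps n) (strictRefinement c β)   ≡⟨ expansionCoeff-fromList c β⊨n ⟨
          expansionCoeff n c (fromList β)                ≡⟨ same (length β) (fromList β) ⟩
          expansionCoeff n c′ (fromList β)               ≡⟨ expansionCoeff-fromList c′ β⊨n ⟩
          c′ β ℤ.+ ∑ℤ (comps n) (strictRefinement c′ β) ∎)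
        where
        open ≡-Reasoning
        coarser : ∀ γ → γ ∈ comps n → strictRefinement c β γ ≡ strictRefinement c′ β γ
        coarser γ γ∈comps with β ≟ₗ γ
        ... | yes _ = refl
        ... | no β≢γ with refines β γ in β≤γ
        ...   | false = trans (ℤ.*-zeroʳ (c γ)) (sym (ℤ.*-zeroʳ (c′ γ)))
        ...   | true  = cong (ℤ._* ℤ.+ 1) (expansion-unique-bounded bound γ shorter (∈comps⇒composition γ∈comps))
          where
          shorter : length γ < bound
          shorter = <-≤-trans (≤∧≢⇒< (refines⇒length-≤ β γ β≤γ) (λ same-length → β≢γ (sym (refines⇒≡ β γ β≤γ same-length))))
                              (≤-pred length<bound)

      expansion-unique : ∀ β → IsComposition n β → c β ≡ c′ β
      expansion-unique β = expansion-unique-bounded (suc (length β)) β ≤-refl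

  -- The expansion of F(M, x)

  module _ {n} (M : Matroid n) where
    open Matroid M

    Exchangeable : Subset n → Fin n → Fin n → Set
    Exchangeable B x y = lookup B x ≡ true × lookup B y ≡ false × IsBase (B [ x ⇄ y ])

    exchangeable? : ∀ B x y → Dec (Exchangeable B x y)
    exchangeable? B x y = (lookup B x Bool.≟ true) ×-dec (lookup B y Bool.≟ false) ×-dec isBase? (B [ x ⇄ y ])

    label : Subset n → Fin n → ℕ
    label B e = (if lookup B e then n else 0) + toℕ e

    label<2n : ∀ B e → label B e < n + n
    label<2n B e with lookup B e
    ... | true  = +-monoʳ-< n (Fin.toℕ<n e)
    ... | false = <-≤-trans (Fin.toℕ<n e) (m≤n+m n n)

    label-injective : ∀ B → Injective _≡_ _≡_ (label B)
    label-injective B {e} {e′} same with lookup B e | lookup B e′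
    ... | true  | true  = Fin.toℕ-injective (+-cancelˡ-≡ n _ _ same)
    ... | false | false = Fin.toℕ-injective same
    ... | true  | false = contradiction (subst (n ≤_) same (m≤m+n n (toℕ e))) (<⇒≱ (Fin.toℕ<n e′))
    ... | false | true  = contradiction (subst (n ≤_) (sym same) (m≤m+n n (toℕ e′))) (<⇒≱ (Fin.toℕ<n e))

    exchangeable⇒label> : ∀ B {x y} → Exchangeable B x y → label B y < label B x
    exchangeable⇒label> B {x} {y} (x∈B , y∉B , _) rewrite x∈B | y∉B = <-≤-trans (Fin.toℕ<n y) (m≤m+n n (toℕ x))

    module PPartitionsAt (B : Subset n) =
      PPartitions (Exchangeable B) (exchangeable? B) (label B) (label-injective B) (n + n) (label<2n B) (exchangeable⇒label> B)
    open PPartitionsAt using (increasing?; increasingPermutation?; descentComposition)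

    χ-localMin≡χ-increasing : ∀ {N} (B : Subset n) (h : Vec (Fin N) n) →
                              χ (isLocalMin? M (asPos h) B) ≡ χ (increasing? B (toℕ ∘ lookup h))
    χ-localMin≡χ-increasing B h = χ-cong (isLocalMin? M (asPos h) B) (increasing? B (toℕ ∘ lookup h))
      (λ localMin x y (x∈B , y∉B , isBase) → ≤-pred (localMin x y x∈B y∉B isBase))
      (λ increasing x y x∈B y∉B isBase → s≤s (increasing x y (x∈B , y∉B , isBase)))

    fundamentalCoefficient : List ℕ → ℕ
    fundamentalCoefficient α =
      ∑[ B ∈ bases M ] ∑[ p ∈ allFuns n n ] (χ (increasingPermutation? B p) * χ (descentComposition B p ≟ₗ α))

    coeffF-∑-bases : ∀ {N} (a : Vec ℕ N) →
      coeffF M a ≡ ∑[ B ∈ bases M ] ∑[ p ∈ allFuns n n ] (χ (increasingPermutation? B p) * coeffL n (descentComposition B p) a)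
    coeffF-∑-bases {N} a = begin
      coeffF M a
        ≡⟨ coeffF-∑ M a ⟩
      ∑[ h ∈ hs ] (χᵇ (isGeneric M (asPos h)) * χ (hasExponent? h a))
        ≡⟨ ∑-cong hs (λ h → cong (_* χ (hasExponent? h a)) (χᵇ-isGeneric M (asPos h))) ⟩
      ∑[ h ∈ hs ] (∑[ B ∈ bases M ] χ (isLocalMin? M (asPos h) B) * χ (hasExponent? h a))
        ≡⟨ ∑-cong hs (λ h → ∑-*ʳ (bases M) (λ B → χ (isLocalMin? M (asPos h) B)) (χ (hasExponent? h a))) ⟨
      ∑[ h ∈ hs ] ∑[ B ∈ bases M ] (χ (isLocalMin? M (asPos h) B) * χ (hasExponent? h a))
        ≡⟨ ∑-cong hs (λ h → ∑-cong (bases M) (λ B → cong (_* χ (hasExponent? h a)) (χ-localMin≡χ-increasing B h))) ⟩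
      ∑[ h ∈ hs ] ∑[ B ∈ bases M ] (χ (increasing? B (toℕ ∘ lookup h)) * χ (hasExponent? h a))
        ≡⟨ ∑-comm hs (bases M) _ ⟩
      ∑[ B ∈ bases M ] ∑[ h ∈ hs ] (χ (increasing? B (toℕ ∘ lookup h)) * χ (hasExponent? h a))
        ≡⟨ ∑-cong (bases M) (λ B → PPartitionsAt.∑-increasing-exponent B a) ⟩
      ∑[ B ∈ bases M ] ∑[ p ∈ allFuns n n ] (χ (increasingPermutation? B p) * coeffL n (descentComposition B p) a) ∎
      where
      open ≡-Reasoning
      hs = allFuns N n

    ∑-fundamentalCoefficient : ∀ {N} (a : Vec ℕ N) →
      ∑[ α ∈ comps n ] (fundamentalCoefficient α * coeffL n α a) ≡
      ∑[ B ∈ bases M ] ∑[ p ∈ allFuns n n ] (χ (increasingPermutation? B p) * coeffL n (descentComposition B p) a)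
    ∑-fundamentalCoefficient a = begin
      ∑[ α ∈ comps n ] (fundamentalCoefficient α * coeffL n α a)
        ≡⟨ ∑-cong (comps n) (λ α → trans (sym (∑-*ʳ (bases M) (λ B → ∑[ p ∈ ps ] contribution B p α) (coeffL n α a)))
                                          (∑-cong (bases M) (λ B → sym (∑-*ʳ ps (λ p → contribution B p α) (coeffL n α a))))) ⟩
      ∑[ α ∈ comps n ] ∑[ B ∈ bases M ] ∑[ p ∈ ps ] (contribution B p α * coeffL n α a)
        ≡⟨ ∑-comm (comps n) (bases M) _ ⟩
      ∑[ B ∈ bases M ] ∑[ α ∈ comps n ] ∑[ p ∈ ps ] (contribution B p α * coeffL n α a)
        ≡⟨ ∑-cong (bases M) (λ B → ∑-comm (comps n) ps _) ⟩
      ∑[ B ∈ bases M ] ∑[ p ∈ ps ] ∑[ α ∈ comps n ] (contribution B p α * coeffL n α a)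
        ≡⟨ ∑-cong (bases M) (λ B → ∑-cong ps (λ p → collapse B p)) ⟩
      ∑[ B ∈ bases M ] ∑[ p ∈ ps ] (χ (increasingPermutation? B p) * coeffL n (descentComposition B p) a) ∎
      where
      open ≡-Reasoning
      ps = allFuns n n
      contribution : Subset n → Vec (Fin n) n → List ℕ → ℕ
      contribution B p α = χ (increasingPermutation? B p) * χ (descentComposition B p ≟ₗ α)
      collapse : ∀ B p → ∑[ α ∈ comps n ] (contribution B p α * coeffL n α a) ≡
                         χ (increasingPermutation? B p) * coeffL n (descentComposition B p) a
      collapse B p = begin
        ∑[ α ∈ comps n ] (contribution B p α * coeffL n α a)
          ≡⟨ ∑-cong (comps n) (λ α → *-assoc (χ (increasingPermutation? B p)) _ _) ⟩
        ∑[ α ∈ comps n ] (χ (increasingPermutation? B p) * (χ (descentComposition B p ≟ₗ α) * coeffL n α a))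
          ≡⟨ ∑-*ˡ (comps n) (λ α → χ (descentComposition B p ≟ₗ α) * coeffL n α a) (χ (increasingPermutation? B p)) ⟩
        χ (increasingPermutation? B p) * ∑[ α ∈ comps n ] (χ (descentComposition B p ≟ₗ α) * coeffL n α a)
          ≡⟨ cong (χ (increasingPermutation? B p) *_) (∑-comps-δ n (descentComposition B p) (λ α → coeffL n α a)) ⟩
        χ (increasingPermutation? B p) * (χ (isComposition? n (descentComposition B p)) * coeffL n (descentComposition B p) a)
          ≡⟨ cong (λ k → χ (increasingPermutation? B p) * (k * coeffL n (descentComposition B p) a))
                  (χ-yes (isComposition? n (descentComposition B p)) (cutComposition-isComposition _ n)) ⟩
        χ (increasingPermutation? B p) * (1 * coeffL n (descentComposition B p) a)
          ≡⟨ cong (χ (increasingPermutation? B p) *_) (*-identityˡ _) ⟩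
        χ (increasingPermutation? B p) * coeffL n (descentComposition B p) a ∎

    fundamental-isLExpansion : IsLExpansion M (λ α → ℤ.+ fundamentalCoefficient α)
    fundamental-isLExpansion N a = sym (begin
      expansionCoeff n (λ α → ℤ.+ fundamentalCoefficient α) a
        ≡⟨ ∑ℤ-cong-∈ (comps n) (λ α _ → ℤ.pos-* (fundamentalCoefficient α) (coeffL n α a)) ⟨
      ∑ℤ (comps n) (λ α → ℤ.+ (fundamentalCoefficient α * coeffL n α a))
        ≡⟨ ∑ℤ-pos (comps n) _ ⟩
      ℤ.+ ∑[ α ∈ comps n ] (fundamentalCoefficient α * coeffL n α a)
        ≡⟨ cong ℤ.+_ (trans (∑-fundamentalCoefficient a) (sym (coeffF-∑-bases a))) ⟩
      ℤ.+ coeffF M a ∎)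
      where open ≡-Reasoning

    χᵇ-isGeneric-injective : (f : Fin n → ℕ) → Injective _≡_ _≡_ f → χᵇ (isGeneric M f) ≡ 1
    χᵇ-isGeneric-injective f inj with B , isBase-B , localMin ← injective⇒localMin M f inj =
      T⇒χᵇ≡1 (localMin⇒generic M f isBase-B localMin)
      where
      T⇒χᵇ≡1 : ∀ {b} → T b → χᵇ b ≡ 1
      T⇒χᵇ≡1 {true} _ = refl

    coeffF-ones : coeffF M (V.replicate n 1) ≡ n !
    coeffF-ones = begin
      coeffF M (V.replicate n 1)
        ≡⟨ coeffF-∑ M (V.replicate n 1) ⟩
      ∑[ h ∈ allFuns n n ] (χᵇ (isGeneric M (asPos h)) * χ (hasExponent? h (V.replicate n 1)))
        ≡⟨ ∑-cong (allFuns n n) (λ h → byInjectivity h (injective? (lookup h))) ⟩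
      ∑[ h ∈ allFuns n n ] χ (injective? (lookup h))
        ≡⟨ count-injective n n ⟩
      n P′ n
        ≡⟨ nP′n≡n! n ⟩
      n ! ∎
      where
      open ≡-Reasoning
      byInjectivity : ∀ h (inj? : Dec (Injective _≡_ _≡_ (lookup h))) →
                      χᵇ (isGeneric M (asPos h)) * χ (hasExponent? h (V.replicate n 1)) ≡ χ inj?
      byInjectivity h (yes inj) = cong₂ _*_
        (χᵇ-isGeneric-injective (asPos h) (λ same → inj (Fin.toℕ-injective (suc-injective same))))
        (χ-yes (hasExponent? h (V.replicate n 1)) (proj₂ (hasExponent-ones⇔injective h) inj))
      byInjectivity h (no ¬inj) = trans
        (cong (χᵇ (isGeneric M (asPos h)) *_) (χ-no (hasExponent? h (V.replicate n 1)) (¬inj ∘ proj₁ (hasExponent-ones⇔injective h))))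
        (*-zeroʳ (χᵇ (isGeneric M (asPos h))))

    ∑-LExpansion : (c : List ℕ → ℤ) → IsLExpansion M c → foldr (λ α s → c α ℤ.+ s) (ℤ.+ 0) (comps n) ≡ ℤ.+ (n !)
    ∑-LExpansion c expansion = begin
      foldr (λ α s → c α ℤ.+ s) (ℤ.+ 0) (comps n)
        ≡⟨ ∑ℤ-foldr (comps n) c ⟨
      ∑ℤ (comps n) c
        ≡⟨ ∑ℤ-cong-∈ (comps n) (λ α α∈comps → trans (sym (ℤ.*-identityʳ (c α)))
                                    (cong (λ k → c α ℤ.* ℤ.+ k) (sym (coeffL-ones n (∈comps⇒composition α∈comps))))) ⟩
      expansionCoeff n c (V.replicate n 1)
        ≡⟨ expansion n (V.replicate n 1) ⟨
      ℤ.+ coeffF M (V.replicate n 1)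
        ≡⟨ cong ℤ.+_ coeffF-ones ⟩
      ℤ.+ (n !) ∎
      where open ≡-Reasoning

    fundamentalCoefficient-ones : fundamentalCoefficient (replicate n 1) ≡ #bases M
    fundamentalCoefficient-ones =
      trans (∑-cong (bases M) PPartitionsAt.#allDescents) (trans (∑-const (bases M) 1) (*-identityʳ _))

open import Data.Integer using (ℤ; +_; _+_; _≤_; +≤+)
open import Data.List using (List; foldr; replicate)
open import Data.List.Membership.Propositional using (_∈_)
open import Data.Nat using (ℕ; _!; z≤n)
open import Data.Product using (∃; _×_; _,_)
open import Defs
open import Relation.Binary.PropositionalEquality using (_≡_; trans; sym; subst; cong)
open FundamentalExpansion using (IsComposition; ∈comps⇒composition; ones-isComposition; expansion-unique;
                                 fundamentalCoefficient; fundamental-isLExpansion; ∑-LExpansion; fundamentalCoefficient-ones)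

corollary5p4 : ∀ {n : ℕ} (M : Matroid n) →
    (∃ λ (c : List ℕ → ℤ) → IsLExpansion M c)
    × (∀ (c : List ℕ → ℤ) → IsLExpansion M c →
    (∀ α → α ∈ comps n → + 0 ≤ c α)
    × (foldr (λ α s → c α + s) (+ 0) (comps n) ≡ + (n !))
    × (c (replicate n 1) ≡ + #bases M))
corollary5p4 {n} M = (c , fundamental-isLExpansion M) , λ c′ c′-expansion →
  let agree : ∀ α → IsComposition n α → c′ α ≡ c α
      agree = expansion-unique n c′ c (λ N a → trans (sym (c′-expansion N a)) (fundamental-isLExpansion M N a))
  in (λ α α∈comps → subst (+ 0 ≤_) (sym (agree α (∈comps⇒composition α∈comps))) (+≤+ z≤n))
   , ∑-LExpansion M c′ c′-expansion
   , trans (agree (replicate n 1) (ones-isComposition n)) (cong +_ (fundamentalCoefficient-ones M))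
  where
  c : List ℕ → ℤ
  c α = + fundamentalCoefficient M α
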